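{- Let $p$ be a prime and $s\ge1$, $n,m\ge2$ integers, and let $i,j$ be integers with $0\le i\le j$ and $i\le m-1$. If $i<m-1$, then \[ \tilde E_i(n\times m,p^s,p^j)=\varphi_n(p^s)\,(p^{s-1})^i\,(p^s)^{m-(i+1)}\,E_i((n-1)\times(m-1),p^s,p^j). \] If $i=m-1$, then \[ \tilde E_{m-1}(n\times m,p^s,p^j)=\varphi_n(p^s)\,(p^{s-1})^{m-1}\,E((n-1)\times(m-1),p^{s-1},p^{j-(m-1)}). \]
   Context: For $t\ge0$, $\mathbb{Z}_{p^t}$ is the ring of integers modulo $p^t$ ($\mathbb{Z}_1$ is the zero ring, whose unique matrix has exactly one solution). $E(a\times b,p^t,p^j)$ is the number of $a\times b$ matrices over $\mathbb{Z}_{p^t}$ such that $Ax\equiv0\pmod{p^t}$ has exactly $p^j$ solutions in $\mathbb{Z}_{p^t}^b$ ($0$ if $j<0$). $E_i(a\times b,p^s,p^j)$ is the number of such $a\times b$ matrices over $\mathbb{Z}_{p^s}$ with exactly $p^j$ solutions whose first $i$ columns have all entries divisible by $p$. A matrix over $\mathbb{Z}_{p^s}$ is relatively prime if some entry is not divisible by $p$; $\tilde E_i(n\times m,p^s,p^j)$ is the number of relatively prime $n\times m$ matrices over $\mathbb{Z}_{p^s}$ with exactly $p^j$ solutions in which the first column containing an entry not divisible by $p$ is column $i+1$. For positive integers $u,c$, $\varphi_u(c)$ is the number of $u$-tuples $(a_1,\dots,a_u)$ with $1\le a_i\le c$ and at least one $a_i$ relatively prime to $c$. -}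

module Defs where

open import Data.Nat using (ℕ; zero; suc; _+_; _*_; _<ᵇ_; _≡ᵇ_)
open import Data.Nat.Divisibility using (_∣?_)
open import Data.Nat.Coprimality using (coprime?)
open import Data.Bool using (Bool; true; false; _∧_; _∨_; not; if_then_else_)
open import Data.Fin using (Fin; toℕ)
open import Data.List using (List; []; _∷_; map; concatMap; allFin; upTo)
open import Data.Bool.ListAction using (all; any)
open import Data.Nat.ListAction using (sum)
open import Data.Vec using (Vec; []; _∷_; lookup; toList; tabulate)
open import Relation.Nullary.Decidable using (⌊_⌋)

count : {A : Set} → (A → Bool) → List A → ℕ
count f []       = 0
count f (x ∷ xs) = (if f x then 1 else 0) + count f xs

vecsOf : {A : Set} → List A → (n : ℕ) → List (Vec A n)
vecsOf xs zero    = [] ∷ []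
vecsOf xs (suc n) = concatMap (λ x → map (x ∷_) (vecsOf xs n)) xs

-- Z_q is modelled as Fin q (residues 0..q-1); a × b matrices as a rows of length b
Mat : ℕ → ℕ → ℕ → Set
Mat q a b = Vec (Vec (Fin q) b) a

allMats : (q a b : ℕ) → List (Mat q a b)
allMats q a b = vecsOf (vecsOf (allFin q) b) a

divB : ℕ → ℕ → Bool
divB d x = ⌊ d ∣? x ⌋

isSolution : {q a b : ℕ} → Mat q a b → Vec (Fin q) b → Bool
isSolution {q} {a} {b} A x =
  all (λ row → divB q (sum (toList (tabulate (λ k → toℕ (lookup row k) * toℕ (lookup x k))))))
      (toList A)

numSolutions : {q a b : ℕ} → Mat q a b → ℕ
numSolutions {q} {a} {b} A = count (isSolution A) (vecsOf (allFin q) b)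

hasSolCount : {q a b : ℕ} → Mat q a b → ℕ → Bool
hasSolCount A N = ⌊ numSolutions A Data.Nat.≟ N ⌋

colDivBy : {q a b : ℕ} → ℕ → Mat q a b → Fin b → Bool
colDivBy p A k = all (λ row → divB p (toℕ (lookup row k))) (toList A)

firstColsDiv : {q a b : ℕ} → ℕ → ℕ → Mat q a b → Bool
firstColsDiv p i A = all (λ k → not (toℕ k <ᵇ i) ∨ colDivBy p A k) (allFin _)

-- A is relatively prime: some entry is not divisible by p
relPrime : {q a b : ℕ} → ℕ → Mat q a b → Bool
relPrime p A = any (λ row → any (λ e → not (divB p (toℕ e))) (toList row)) (toList A)

E : (p a b t N : ℕ) → ℕ
E p a b t N = count (λ A → hasSolCount A N) (allMats (p Data.Nat.^ t) a b)

Ei : (p i a b s N : ℕ) → ℕ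
Ei p i a b s N =
  count (λ A → firstColsDiv p i A ∧ hasSolCount A N) (allMats (p Data.Nat.^ s) a b)

-- Ẽ_i(n×m, p^s, N): relatively prime matrices with exactly N solutions whose first
-- column containing an entry not divisible by p is column i+1 (0-based index i)
Etilde : (p i n m s N : ℕ) → ℕ
Etilde p i n m s N =
  count (λ A → relPrime p A ∧ firstColsDiv p i A
               ∧ any (λ k → (toℕ k ≡ᵇ i) ∧ not (colDivBy p A k)) (allFin m)
               ∧ hasSolCount A N)
        (allMats (p Data.Nat.^ s) n m)

φ : (u c : ℕ) → ℕ
φ u c = count (λ v → any (λ a → ⌊ coprime? a c ⌋) (toList v))
              (vecsOf (map suc (upTo c)) u)

-- Split a matrix counted by Ẽ_i into its column i, c, and the remaining columns. Since c has an entry u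
-- prime to p, say in row r, the equation of row r determines x_i = -u⁻¹ (row_r · y) from the other
-- unknowns y, and substituting it turns every other row into itself plus a multiple of row r. Because the
-- first i entries of row r are divisible by p, this shear preserves the divisibility condition on the other
-- rows, and it is a translation of ℤ_{p^s}^{m-1}, so it preserves counts. Summing over the pivot row
-- ((p^{s-1})^i (p^s)^{m-1-i} choices) and over c (φ_n(p^s) choices) gives the first formula. For i = m-1
-- all entries of the reduced (n-1)×(m-1) matrix are divisible by p, so it is p·B with B over ℤ_{p^{s-1}};
-- its solutions mod p^s are the p^{m-1} lifts of each solution of B mod p^{s-1}.

module Submission where

open import Defs
open import Data.Nat
open import Data.Nat.Properties
open import Data.Nat.DivMod
open import Data.Nat.Divisibility
open import Data.Nat.Primality using (Prime; prime⇒irreducible; prime⇒nonZero; ¬prime[1])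
open import Data.Nat.Coprimality using (Coprime; coprime?; coprime-divisor; coprime-Bézout)
open import Data.Nat.GCD using (module Bézout)
open import Data.Nat.ListAction using (sum)
open import Data.Nat.Tactic.RingSolver using (solve-∀)
open import Data.Bool using (Bool; true; false; _∧_; _∨_; not; if_then_else_)
open import Data.Bool.Properties using (∧-assoc; ∧-comm; ∧-zeroʳ; ∧-conicalˡ; ∧-conicalʳ; T-≡)
open import Data.Bool.ListAction using (all; any)
open import Data.List using (List; []; _∷_; map; concatMap; concat; _++_; length; applyUpTo; upTo; allFin)
import Data.List as List
open import Data.List.Properties using (length-map; length-upTo; length-tabulate; map-tabulate)
open import Data.Vec using (Vec; []; _∷_; toList; lookup; tabulate; insertAt; removeAt; zipWith)
import Data.Vec as Vec
open import Data.Vec.Properties using (lookup-zipWith; insertAt-lookup; insertAt-removeAt)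
open import Data.Fin using (Fin; toℕ; fromℕ<) renaming (zero to fzero; suc to fsuc)
open import Data.Fin.Properties using (toℕ-injective; toℕ-fromℕ<; toℕ<n)
import Data.Fin.Properties as Fin
open import Data.Product using (Σ; _,_; _×_; proj₁; proj₂)
open import Data.Sum using (inj₁; inj₂)
open import Function using (_∘_; id; Equivalence)
open import Relation.Nullary using (¬_; yes; no; contradiction)
open import Relation.Nullary.Decidable using (⌊_⌋)
open import Relation.Binary.PropositionalEquality
open ≡-Reasoning

𝟙 : Bool → ℕ
𝟙 b = if b then 1 else 0

𝟙-∧ : ∀ a b → 𝟙 (a ∧ b) ≡ 𝟙 a * 𝟙 b
𝟙-∧ true  b = sym (+-identityʳ (𝟙 b))
𝟙-∧ false b = refl

∑ : {A : Set} → List A → (A → ℕ) → ℕ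
∑ []       f = 0
∑ (x ∷ xs) f = f x + ∑ xs f

count≡∑𝟙 : {A : Set} (f : A → Bool) (xs : List A) → count f xs ≡ ∑ xs (𝟙 ∘ f)
count≡∑𝟙 f []       = refl
count≡∑𝟙 f (x ∷ xs) = cong (𝟙 (f x) +_) (count≡∑𝟙 f xs)

∑-cong : {A : Set} (xs : List A) {f g : A → ℕ} → (∀ x → f x ≡ g x) → ∑ xs f ≡ ∑ xs g
∑-cong []       f≗g = refl
∑-cong (x ∷ xs) f≗g = cong₂ _+_ (f≗g x) (∑-cong xs f≗g)

∑-++ : {A : Set} (xs ys : List A) (f : A → ℕ) → ∑ (xs ++ ys) f ≡ ∑ xs f + ∑ ys f
∑-++ []       ys f = refl
∑-++ (x ∷ xs) ys f = trans (cong (f x +_) (∑-++ xs ys f)) (sym (+-assoc (f x) _ _))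

∑-map : {A B : Set} (g : A → B) (xs : List A) (f : B → ℕ) → ∑ (map g xs) f ≡ ∑ xs (f ∘ g)
∑-map g []       f = refl
∑-map g (x ∷ xs) f = cong (f (g x) +_) (∑-map g xs f)

∑-concatMap : {A B : Set} (g : A → List B) (xs : List A) (f : B → ℕ) →
  ∑ (concatMap g xs) f ≡ ∑ xs (λ x → ∑ (g x) f)
∑-concatMap g []       f = refl
∑-concatMap g (x ∷ xs) f =
  trans (∑-++ (g x) (concat (map g xs)) f) (cong (∑ (g x) f +_) (∑-concatMap g xs f))

∑-+ : {A : Set} (xs : List A) (f g : A → ℕ) → ∑ xs (λ x → f x + g x) ≡ ∑ xs f + ∑ xs g
∑-+ []       f g = refl
∑-+ (x ∷ xs) f g =
  trans (cong (f x + g x +_) (∑-+ xs f g)) (interchange (f x) (g x) (∑ xs f) (∑ xs g))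
  where
  interchange : ∀ a b c d → a + b + (c + d) ≡ a + c + (b + d)
  interchange = solve-∀

∑-*ˡ : {A : Set} (xs : List A) (k : ℕ) (f : A → ℕ) → ∑ xs (λ x → k * f x) ≡ k * ∑ xs f
∑-*ˡ []       k f = sym (*-zeroʳ k)
∑-*ˡ (x ∷ xs) k f = trans (cong (k * f x +_) (∑-*ˡ xs k f)) (sym (*-distribˡ-+ k (f x) (∑ xs f)))

∑-𝟙-∧ : {A : Set} (xs : List A) (b : Bool) (g : A → Bool) →
  ∑ xs (λ x → 𝟙 (b ∧ g x)) ≡ 𝟙 b * ∑ xs (𝟙 ∘ g)
∑-𝟙-∧ xs b g = trans (∑-cong xs (λ x → 𝟙-∧ b (g x))) (∑-*ˡ xs (𝟙 b) (𝟙 ∘ g))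

𝟙-*-cong : ∀ b {x y} → (b ≡ true → x ≡ y) → 𝟙 b * x ≡ 𝟙 b * y
𝟙-*-cong true  x≡y = cong (1 *_) (x≡y refl)
𝟙-*-cong false x≡y = refl

∑-*ʳ : {A : Set} (xs : List A) (k : ℕ) (f : A → ℕ) → ∑ xs (λ x → f x * k) ≡ ∑ xs f * k
∑-*ʳ xs k f = trans (∑-cong xs (λ x → *-comm (f x) k)) (trans (∑-*ˡ xs k f) (*-comm k (∑ xs f)))

∑-const : {A : Set} (xs : List A) (k : ℕ) → ∑ xs (λ _ → k) ≡ length xs * k
∑-const []       k = refl
∑-const (x ∷ xs) k = cong (k +_) (∑-const xs k)

∑-swap : {A B : Set} (xs : List A) (ys : List B) (f : A → B → ℕ) →
  ∑ xs (λ x → ∑ ys (f x)) ≡ ∑ ys (λ y → ∑ xs (λ x → f x y))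
∑-swap []       ys f = sym (trans (∑-const ys 0) (*-zeroʳ (length ys)))
∑-swap (x ∷ xs) ys f =
  trans (cong (∑ ys (f x) +_) (∑-swap xs ys f)) (sym (∑-+ ys (f x) (λ y → ∑ xs (λ x′ → f x′ y))))

∑-vecsOf-suc : {A : Set} (xs : List A) (n : ℕ) (f : Vec A (suc n) → ℕ) →
  ∑ (vecsOf xs (suc n)) f ≡ ∑ xs (λ x → ∑ (vecsOf xs n) (λ v → f (x ∷ v)))
∑-vecsOf-suc xs n f = trans (∑-concatMap (λ x → map (x ∷_) (vecsOf xs n)) xs f)
  (∑-cong xs (λ x → ∑-map (x ∷_) (vecsOf xs n) f))

length-vecsOf : {A : Set} (xs : List A) (n : ℕ) → ∑ (vecsOf xs n) (λ _ → 1) ≡ length xs ^ n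
length-vecsOf xs zero    = refl
length-vecsOf xs (suc n) = begin
  ∑ (vecsOf xs (suc n)) (λ _ → 1)          ≡⟨ ∑-vecsOf-suc xs n (λ _ → 1) ⟩
  ∑ xs (λ _ → ∑ (vecsOf xs n) (λ _ → 1))   ≡⟨ ∑-const xs _ ⟩
  length xs * ∑ (vecsOf xs n) (λ _ → 1)    ≡⟨ cong (length xs *_) (length-vecsOf xs n) ⟩
  length xs * length xs ^ n                ∎

∑-vecsOf-insertAt : {A : Set} (xs : List A) (n : ℕ) (i : Fin (suc n)) (f : Vec A (suc n) → ℕ) →
  ∑ (vecsOf xs (suc n)) f ≡ ∑ xs (λ x → ∑ (vecsOf xs n) (λ w → f (insertAt w i x)))
∑-vecsOf-insertAt xs n       fzero    f = ∑-vecsOf-suc xs n f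
∑-vecsOf-insertAt xs (suc n) (fsuc i) f = begin
  ∑ (vecsOf xs (suc (suc n))) f
    ≡⟨ ∑-vecsOf-suc xs (suc n) f ⟩
  ∑ xs (λ y → ∑ (vecsOf xs (suc n)) (λ v → f (y ∷ v)))
    ≡⟨ ∑-cong xs (λ y → ∑-vecsOf-insertAt xs n i (λ v → f (y ∷ v))) ⟩
  ∑ xs (λ y → ∑ xs (λ x → ∑ (vecsOf xs n) (λ w → f (y ∷ insertAt w i x))))
    ≡⟨ ∑-swap xs xs _ ⟩
  ∑ xs (λ x → ∑ xs (λ y → ∑ (vecsOf xs n) (λ w → f (y ∷ insertAt w i x))))
    ≡⟨ ∑-cong xs (λ x → sym (∑-vecsOf-suc xs n (λ w → f (insertAt w (fsuc i) x)))) ⟩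
  ∑ xs (λ x → ∑ (vecsOf xs (suc n)) (λ w → f (insertAt w (fsuc i) x))) ∎

∑< : ℕ → (ℕ → ℕ) → ℕ
∑< zero    h = 0
∑< (suc n) h = h 0 + ∑< n (h ∘ suc)

∑-applyUpTo : (f : ℕ → ℕ) (n : ℕ) (h : ℕ → ℕ) → ∑ (applyUpTo f n) h ≡ ∑< n (h ∘ f)
∑-applyUpTo f zero    h = refl
∑-applyUpTo f (suc n) h = cong (h (f 0) +_) (∑-applyUpTo (f ∘ suc) n h)

∑<-cong : (n : ℕ) {h h′ : ℕ → ℕ} → (∀ k → k < n → h k ≡ h′ k) → ∑< n h ≡ ∑< n h′
∑<-cong zero    e = refl
∑<-cong (suc n) e = cong₂ _+_ (e 0 z<s) (∑<-cong n (λ k k<n → e (suc k) (s<s k<n)))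

∑<-0 : (n : ℕ) (h : ℕ → ℕ) → (∀ k → k < n → h k ≡ 0) → ∑< n h ≡ 0
∑<-0 n h h≡0 = trans (∑<-cong n h≡0) (zeros n)
  where
  zeros : ∀ n → ∑< n (λ _ → 0) ≡ 0
  zeros zero    = refl
  zeros (suc n) = zeros n

∑<-+ : (a b : ℕ) (h : ℕ → ℕ) → ∑< (a + b) h ≡ ∑< a h + ∑< b (λ k → h (a + k))
∑<-+ zero    b h = refl
∑<-+ (suc a) b h = trans (cong (h 0 +_) (∑<-+ a b (h ∘ suc))) (sym (+-assoc (h 0) _ _))

∑<-snoc : (n : ℕ) (h : ℕ → ℕ) → ∑< (suc n) h ≡ ∑< n h + h n
∑<-snoc n h = begin
  ∑< (suc n) h               ≡⟨ cong (λ k → ∑< k h) (+-comm 1 n) ⟩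
  ∑< (n + 1) h               ≡⟨ ∑<-+ n 1 h ⟩
  ∑< n h + (h (n + 0) + 0)   ≡⟨ cong (λ k → ∑< n h + (h k + 0)) (+-identityʳ n) ⟩
  ∑< n h + (h n + 0)         ≡⟨ cong (∑< n h +_) (+-identityʳ (h n)) ⟩
  ∑< n h + h n               ∎

∑<-point : (n x₀ : ℕ) (h : ℕ → ℕ) → x₀ < n → (∀ k → k < n → k ≢ x₀ → h k ≡ 0) → ∑< n h ≡ h x₀
∑<-point (suc n) zero h _ h≡0 =
  trans (cong (h 0 +_) (∑<-0 n (h ∘ suc) (λ k k<n → h≡0 (suc k) (s<s k<n) (λ ())))) (+-identityʳ _)
∑<-point (suc n) (suc x₀) h (s<s x₀<n) h≡0 =
  cong₂ _+_ (h≡0 0 z<s (λ ()))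
            (∑<-point n x₀ (h ∘ suc) x₀<n (λ k k<n k≢x₀ → h≡0 (suc k) (s<s k<n) (k≢x₀ ∘ suc-injective)))

∑<-rotate : (n : ℕ) (h : ℕ → ℕ) → h n ≡ h 0 → ∑< n (h ∘ suc) ≡ ∑< n h
∑<-rotate n h hn≡h0 = +-cancelˡ-≡ (h 0) _ _ (begin
  h 0 + ∑< n (h ∘ suc)  ≡⟨ ∑<-snoc n h ⟩
  ∑< n h + h n          ≡⟨ cong (∑< n h +_) hn≡h0 ⟩
  ∑< n h + h 0          ≡⟨ +-comm (∑< n h) (h 0) ⟩
  h 0 + ∑< n h          ∎)

∑<-periodic-shift : (q : ℕ) (h : ℕ → ℕ) → (∀ k → h (k + q) ≡ h k) →
  ∀ t → ∑< q (λ k → h (k + t)) ≡ ∑< q h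
∑<-periodic-shift q h periodic zero = ∑<-cong q (λ k _ → cong h (+-identityʳ k))
∑<-periodic-shift q h periodic (suc t) = begin
  ∑< q (λ k → h (k + suc t))          ≡⟨ ∑<-cong q (λ k _ → cong h (+-suc k t)) ⟩
  ∑< q ((λ k → h (k + t)) ∘ suc)      ≡⟨ ∑<-rotate q (λ k → h (k + t)) (trans (cong h (+-comm q t)) (periodic t)) ⟩
  ∑< q (λ k → h (k + t))              ≡⟨ ∑<-periodic-shift q h periodic t ⟩
  ∑< q h                              ∎

∑<-periodic-blocks : (r q : ℕ) (h : ℕ → ℕ) → (∀ k → h (q + k) ≡ h k) → ∑< (r * q) h ≡ r * ∑< q h
∑<-periodic-blocks zero    q h periodic = refl
∑<-periodic-blocks (suc r) q h periodic = begin
  ∑< (q + r * q) h                         ≡⟨ ∑<-+ q (r * q) h ⟩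
  ∑< q h + ∑< (r * q) (λ k → h (q + k))    ≡⟨ cong (∑< q h +_) (∑<-cong (r * q) (λ k _ → periodic k)) ⟩
  ∑< q h + ∑< (r * q) h                    ≡⟨ cong (∑< q h +_) (∑<-periodic-blocks r q h periodic) ⟩
  ∑< q h + r * ∑< q h                      ∎

module Congruence (q : ℕ) .{{_ : NonZero q}} where

  infix 4 _≋_
  _≋_ : ℕ → ℕ → Set
  a ≋ b = a % q ≡ b % q

  ≡⇒≋ : ∀ {a b} → a ≡ b → a ≋ b
  ≡⇒≋ = cong (_% q)

  %-≋ : ∀ a → a % q ≋ a
  %-≋ a = m%n%n≡m%n a q

  +-≋ : ∀ {a a′ b b′} → a ≋ a′ → b ≋ b′ → a + b ≋ a′ + b′
  +-≋ {a} {a′} {b} {b′} a≋a′ b≋b′ = begin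
    (a + b) % q              ≡⟨ %-distribˡ-+ a b q ⟩
    (a % q + b % q) % q      ≡⟨ cong₂ (λ x y → (x + y) % q) a≋a′ b≋b′ ⟩
    (a′ % q + b′ % q) % q    ≡⟨ %-distribˡ-+ a′ b′ q ⟨
    (a′ + b′) % q            ∎

  *-≋ : ∀ {a a′ b b′} → a ≋ a′ → b ≋ b′ → a * b ≋ a′ * b′
  *-≋ {a} {a′} {b} {b′} a≋a′ b≋b′ = begin
    (a * b) % q                ≡⟨ %-distribˡ-* a b q ⟩
    (a % q * (b % q)) % q      ≡⟨ cong₂ (λ x y → (x * y) % q) a≋a′ b≋b′ ⟩
    (a′ % q * (b′ % q)) % q    ≡⟨ %-distribˡ-* a′ b′ q ⟨
    (a′ * b′) % q              ∎

  0%q≡0 : 0 % q ≡ 0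
  0%q≡0 = m<n⇒m%n≡m (>-nonZero⁻¹ q)

  ∣⇒≋0 : ∀ {a} → q ∣ a → a ≋ 0
  ∣⇒≋0 {a} q∣a = trans (n∣m⇒m%n≡0 a q q∣a) (sym 0%q≡0)

  ≋0⇒∣ : ∀ {a} → a ≋ 0 → q ∣ a
  ≋0⇒∣ {a} a≋0 = m%n≡0⇒n∣m a q (trans a≋0 0%q≡0)

  -- Adding c * (q ∸ 1) completes c to a multiple of q; this avoids subtraction.
  +-cancelʳ-≋ : ∀ {a b c} → a + c ≋ b + c → a ≋ b
  +-cancelʳ-≋ {a} {b} {c} a+c≋b+c = begin
    a % q                        ≡⟨ complete a ⟨
    (a + c + c * (q ∸ 1)) % q    ≡⟨ +-≋ a+c≋b+c (refl {x = (c * (q ∸ 1)) % q}) ⟩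
    (b + c + c * (q ∸ 1)) % q    ≡⟨ complete b ⟩
    b % q                        ∎
    where
    c+c[q-1]≡c*q : c + c * (q ∸ 1) ≡ c * q
    c+c[q-1]≡c*q = begin
      c + c * (q ∸ 1)    ≡⟨ cong (_+ c * (q ∸ 1)) (*-identityʳ c) ⟨
      c * 1 + c * (q ∸ 1) ≡⟨ *-distribˡ-+ c 1 (q ∸ 1) ⟨
      c * (1 + (q ∸ 1))  ≡⟨ cong (c *_) (m+[n∸m]≡n (>-nonZero⁻¹ q)) ⟩
      c * q              ∎
    complete : ∀ x → (x + c + c * (q ∸ 1)) % q ≡ x % q
    complete x = begin
      (x + c + c * (q ∸ 1)) % q   ≡⟨ cong (_% q) (trans (+-assoc x c _) (cong (x +_) c+c[q-1]≡c*q)) ⟩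
      (x + c * q) % q             ≡⟨ [m+kn]%n≡m%n x c q ⟩
      x % q                       ∎

divB⇒∣ : ∀ d x → divB d x ≡ true → d ∣ x
divB⇒∣ d x divB≡true with d ∣? x
... | yes d∣x = d∣x

∣⇒divB : ∀ d x → d ∣ x → divB d x ≡ true
∣⇒divB d x d∣x with d ∣? x
... | yes _   = refl
... | no  d∤x = contradiction d∣x d∤x

∤⇒¬divB : ∀ d x → ¬ d ∣ x → divB d x ≡ false
∤⇒¬divB d x d∤x with d ∣? x
... | yes d∣x = contradiction d∣x d∤x
... | no  _   = refl

divB-cong-% : ∀ d .{{_ : NonZero d}} {a b} → a % d ≡ b % d → divB d a ≡ divB d b
divB-cong-% d {a} {b} a≋b with d ∣? a | d ∣? b
... | yes _   | yes _   = refl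
... | no  _   | no  _   = refl
... | yes d∣a | no  d∤b = contradiction (≋0⇒∣ (trans (sym a≋b) (∣⇒≋0 d∣a))) d∤b
  where open Congruence d
... | no  d∤a | yes d∣b = contradiction (≋0⇒∣ (trans a≋b (∣⇒≋0 d∣b))) d∤a
  where open Congruence d

∑-allFin-suc : ∀ n (f : Fin (suc n) → ℕ) → ∑ (allFin (suc n)) f ≡ f fzero + ∑ (allFin n) (f ∘ fsuc)
∑-allFin-suc n f = cong (f fzero +_) (begin
  ∑ (List.tabulate fsuc) f          ≡⟨ cong (λ xs → ∑ xs f) (map-tabulate id fsuc) ⟨
  ∑ (map fsuc (allFin n)) f         ≡⟨ ∑-map fsuc (allFin n) f ⟩
  ∑ (allFin n) (f ∘ fsuc)           ∎)

∑-allFin-toℕ : ∀ n (f : Fin n → ℕ) (h : ℕ → ℕ) → (∀ x → f x ≡ h (toℕ x)) → ∑ (allFin n) f ≡ ∑< n h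
∑-allFin-toℕ zero    f h f≗h = refl
∑-allFin-toℕ (suc n) f h f≗h = trans (∑-allFin-suc n f)
  (cong₂ _+_ (f≗h fzero) (∑-allFin-toℕ n (f ∘ fsuc) (h ∘ suc) (f≗h ∘ fsuc)))

∑-allFin-point : ∀ n (f : Fin n → ℕ) (x₀ : Fin n) → (∀ x → x ≢ x₀ → f x ≡ 0) → ∑ (allFin n) f ≡ f x₀
∑-allFin-point (suc n) f fzero f≡0 = begin
  ∑ (allFin (suc n)) f                   ≡⟨ ∑-allFin-suc n f ⟩
  f fzero + ∑ (allFin n) (f ∘ fsuc)      ≡⟨ cong (f fzero +_) (∑-cong (allFin n) (λ x → f≡0 (fsuc x) (λ ()))) ⟩
  f fzero + ∑ (allFin n) (λ _ → 0)       ≡⟨ cong (f fzero +_) (∑-const (allFin n) 0) ⟩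
  f fzero + length (allFin n) * 0        ≡⟨ cong (f fzero +_) (*-zeroʳ (length (allFin n))) ⟩
  f fzero + 0                            ≡⟨ +-identityʳ _ ⟩
  f fzero                                ∎
∑-allFin-point (suc n) f (fsuc x₀) f≡0 = trans (∑-allFin-suc n f)
  (cong₂ _+_ (f≡0 fzero (λ ()))
             (∑-allFin-point n (f ∘ fsuc) x₀ (λ x x≢x₀ → f≡0 (fsuc x) (x≢x₀ ∘ Fin.suc-injective))))

length-allFin : ∀ n → length (allFin n) ≡ n
length-allFin n = length-tabulate id

toℕ-mod : ∀ a q .{{_ : NonZero q}} → toℕ (a mod q) ≡ a % q
toℕ-mod a q = toℕ-fromℕ< (m%n<n a q)

toℕ-mod-< : ∀ {a q} .{{_ : NonZero q}} → a < q → toℕ (a mod q) ≡ a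
toℕ-mod-< {a} {q} a<q = trans (toℕ-mod a q) (m<n⇒m%n≡m a<q)

toℕ-mod-id : ∀ {q} .{{_ : NonZero q}} (x : Fin q) → toℕ x mod q ≡ x
toℕ-mod-id x = toℕ-injective (toℕ-mod-< (toℕ<n x))

mod-cong-% : ∀ {a b} q .{{_ : NonZero q}} → a % q ≡ b % q → a mod q ≡ b mod q
mod-cong-% {a} {b} q a≋b = toℕ-injective (trans (toℕ-mod a q) (trans a≋b (sym (toℕ-mod b q))))

∑-allFin-mod : ∀ q .{{_ : NonZero q}} (f : Fin q → ℕ) → ∑ (allFin q) f ≡ ∑< q (λ a → f (a mod q))
∑-allFin-mod q f = ∑-allFin-toℕ q f (λ a → f (a mod q)) (λ x → cong f (sym (toℕ-mod-id x)))

∑-allFin-translate : ∀ q .{{_ : NonZero q}} (t : ℕ) (f : Fin q → ℕ) →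
  ∑ (allFin q) (λ x → f ((toℕ x + t) mod q)) ≡ ∑ (allFin q) f
∑-allFin-translate q t f = begin
  ∑ (allFin q) (λ x → f ((toℕ x + t) mod q))      ≡⟨ ∑-allFin-mod q _ ⟩
  ∑< q (λ a → f ((toℕ (a mod q) + t) mod q))      ≡⟨ ∑<-cong q (λ a _ → cong f (mod-cong-% q (reduce a))) ⟩
  ∑< q (λ a → h (a + t))                          ≡⟨ ∑<-periodic-shift q h periodic t ⟩
  ∑< q h                                          ≡⟨ ∑-allFin-mod q f ⟨
  ∑ (allFin q) f                                  ∎
  where
  open Congruence q
  h : ℕ → ℕ
  h a = f (a mod q)
  periodic : ∀ k → h (k + q) ≡ h k
  periodic k = cong f (mod-cong-% q (%-remove-+ʳ k (∣-refl {q})))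
  reduce : ∀ a → toℕ (a mod q) + t ≋ a + t
  reduce a = +-≋ (trans (≡⇒≋ (toℕ-mod a q)) (%-≋ a)) refl

∑-allFin-reduce : ∀ p q′ .{{_ : NonZero q′}} .{{_ : NonZero (p * q′)}} (f : Fin q′ → ℕ) →
  ∑ (allFin (p * q′)) (λ y → f (toℕ y mod q′)) ≡ p * ∑ (allFin q′) f
∑-allFin-reduce p q′ f = begin
  ∑ (allFin (p * q′)) (λ y → f (toℕ y mod q′))      ≡⟨ ∑-allFin-mod (p * q′) _ ⟩
  ∑< (p * q′) (λ a → f (toℕ (a mod (p * q′)) mod q′))
                                                      ≡⟨ ∑<-cong (p * q′) (λ a a< → cong (λ z → f (z mod q′)) (toℕ-mod-< a<)) ⟩
  ∑< (p * q′) (λ a → f (a mod q′))                    ≡⟨ ∑<-periodic-blocks p q′ _ periodic ⟩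
  p * ∑< q′ (λ a → f (a mod q′))                      ≡⟨ cong (p *_) (∑-allFin-mod q′ f) ⟨
  p * ∑ (allFin q′) f                                 ∎
  where
  periodic : ∀ k → f ((q′ + k) mod q′) ≡ f (k mod q′)
  periodic k = cong f (mod-cong-% q′ (%-remove-+ˡ k (∣-refl {q′})))

∑<-multiples : ∀ p .{{_ : NonZero p}} (q′ : ℕ) (g : ℕ → ℕ) →
  ∑< (p * q′) (λ a → 𝟙 (divB p a) * g a) ≡ ∑< q′ (λ b → g (p * b))
∑<-multiples p zero g = cong (λ z → ∑< z (λ a → 𝟙 (divB p a) * g a)) (*-zeroʳ p)
∑<-multiples p (suc q′) g = begin
  ∑< (p * suc q′) (λ a → 𝟙 (divB p a) * g a)
    ≡⟨ cong (λ z → ∑< z (λ a → 𝟙 (divB p a) * g a)) (*-suc p q′) ⟩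
  ∑< (p + p * q′) (λ a → 𝟙 (divB p a) * g a)
    ≡⟨ ∑<-+ p (p * q′) _ ⟩
  ∑< p (λ a → 𝟙 (divB p a) * g a) + ∑< (p * q′) (λ k → 𝟙 (divB p (p + k)) * g (p + k))
    ≡⟨ cong₂ _+_ firstBlock (∑<-cong (p * q′) (λ k _ → cong (λ b → 𝟙 b * g (p + k)) (divB-p+ k))) ⟩
  g 0 + ∑< (p * q′) (λ k → 𝟙 (divB p k) * g (p + k))
    ≡⟨ cong (g 0 +_) (∑<-multiples p q′ (λ k → g (p + k))) ⟩
  g 0 + ∑< q′ (λ b → g (p + p * b))
    ≡⟨ cong₂ (λ z w → g z + w) (*-zeroʳ p) (∑<-cong q′ (λ b _ → cong g (*-suc p b))) ⟨
  ∑< (suc q′) (λ b → g (p * b)) ∎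
  where
  divB-p+ : ∀ k → divB p (p + k) ≡ divB p k
  divB-p+ k = divB-cong-% p (%-remove-+ˡ k (∣-refl {p}))
  firstBlock : ∑< p (λ a → 𝟙 (divB p a) * g a) ≡ g 0
  firstBlock = trans (∑<-point p 0 _ (>-nonZero⁻¹ p) off0)
    (trans (cong (λ b → 𝟙 b * g 0) (∣⇒divB p 0 (p ∣0))) (+-identityʳ (g 0)))
    where
    off0 : ∀ k → k < p → k ≢ 0 → 𝟙 (divB p k) * g k ≡ 0
    off0 zero    _   0≢0 = contradiction refl 0≢0
    off0 (suc k) k<p _   = cong (λ b → 𝟙 b * g (suc k)) (∤⇒¬divB p (suc k) (λ p∣ → <⇒≱ k<p (∣⇒≤ p∣)))

∑-allFin-multiples : ∀ p q′ .{{_ : NonZero p}} .{{_ : NonZero q′}} .{{_ : NonZero (p * q′)}}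
  (f : Fin (p * q′) → ℕ) →
  ∑ (allFin (p * q′)) (λ x → 𝟙 (divB p (toℕ x)) * f x) ≡ ∑ (allFin q′) (λ y → f ((p * toℕ y) mod (p * q′)))
∑-allFin-multiples p q′ f = begin
  ∑ (allFin (p * q′)) (λ x → 𝟙 (divB p (toℕ x)) * f x)
    ≡⟨ ∑-allFin-mod (p * q′) _ ⟩
  ∑< (p * q′) (λ a → 𝟙 (divB p (toℕ (a mod (p * q′)))) * f (a mod (p * q′)))
    ≡⟨ ∑<-cong (p * q′) (λ a a< → cong (λ z → 𝟙 (divB p z) * f (a mod (p * q′))) (toℕ-mod-< a<)) ⟩
  ∑< (p * q′) (λ a → 𝟙 (divB p a) * f (a mod (p * q′)))
    ≡⟨ ∑<-multiples p q′ (λ a → f (a mod (p * q′))) ⟩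
  ∑< q′ (λ b → f ((p * b) mod (p * q′)))
    ≡⟨ ∑<-cong q′ (λ b b< → cong (λ z → f ((p * z) mod (p * q′))) (toℕ-mod-< b<)) ⟨
  ∑< q′ (λ b → f ((p * toℕ (b mod q′)) mod (p * q′)))
    ≡⟨ ∑-allFin-mod q′ _ ⟨
  ∑ (allFin q′) (λ y → f ((p * toℕ y) mod (p * q′))) ∎

allᵥ : {A : Set} {k : ℕ} → (A → Bool) → Vec A k → Bool
allᵥ P v = all P (toList v)

∑-vecsOf-invariant : {A T : Set} (xs : List A) (act : T → A → A) →
  (∀ t (f : A → ℕ) → ∑ xs (f ∘ act t) ≡ ∑ xs f) →
  ∀ k (ts : Vec T k) (f : Vec A k → ℕ) → ∑ (vecsOf xs k) (f ∘ zipWith act ts) ≡ ∑ (vecsOf xs k) f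
∑-vecsOf-invariant xs act inv zero    []       f = refl
∑-vecsOf-invariant xs act inv (suc k) (t ∷ ts) f = begin
  ∑ (vecsOf xs (suc k)) (f ∘ zipWith act (t ∷ ts))
    ≡⟨ ∑-vecsOf-suc xs k _ ⟩
  ∑ xs (λ x → ∑ (vecsOf xs k) (λ v → f (act t x ∷ zipWith act ts v)))
    ≡⟨ ∑-cong xs (λ x → ∑-vecsOf-invariant xs act inv k ts (λ v → f (act t x ∷ v))) ⟩
  ∑ xs (λ x → ∑ (vecsOf xs k) (λ v → f (act t x ∷ v)))
    ≡⟨ inv t (λ y → ∑ (vecsOf xs k) (λ v → f (y ∷ v))) ⟩
  ∑ xs (λ x → ∑ (vecsOf xs k) (λ v → f (x ∷ v)))
    ≡⟨ ∑-vecsOf-suc xs k f ⟨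
  ∑ (vecsOf xs (suc k)) f ∎

∑-vecsOf-restrict : {A B : Set} (xs : List A) (ys : List B) (P : A → Bool) (e : B → A) →
  (∀ (f : A → ℕ) → ∑ xs (λ x → 𝟙 (P x) * f x) ≡ ∑ ys (f ∘ e)) →
  ∀ k (f : Vec A k → ℕ) → ∑ (vecsOf xs k) (λ v → 𝟙 (allᵥ P v) * f v) ≡ ∑ (vecsOf ys k) (f ∘ Vec.map e)
∑-vecsOf-restrict xs ys P e restrict zero    f = cong (_+ 0) (*-identityˡ (f []))
∑-vecsOf-restrict xs ys P e restrict (suc k) f = begin
  ∑ (vecsOf xs (suc k)) (λ v → 𝟙 (allᵥ P v) * f v)
    ≡⟨ ∑-vecsOf-suc xs k _ ⟩
  ∑ xs (λ x → ∑ (vecsOf xs k) (λ v → 𝟙 (P x ∧ allᵥ P v) * f (x ∷ v)))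
    ≡⟨ ∑-cong xs (λ x → factor x) ⟩
  ∑ xs (λ x → 𝟙 (P x) * ∑ (vecsOf xs k) (λ v → 𝟙 (allᵥ P v) * f (x ∷ v)))
    ≡⟨ ∑-cong xs (λ x → cong (𝟙 (P x) *_) (∑-vecsOf-restrict xs ys P e restrict k (λ v → f (x ∷ v)))) ⟩
  ∑ xs (λ x → 𝟙 (P x) * ∑ (vecsOf ys k) (λ w → f (x ∷ Vec.map e w)))
    ≡⟨ restrict _ ⟩
  ∑ ys (λ y → ∑ (vecsOf ys k) (λ w → f (e y ∷ Vec.map e w)))
    ≡⟨ ∑-vecsOf-suc ys k _ ⟨
  ∑ (vecsOf ys (suc k)) (f ∘ Vec.map e) ∎
  where
  factor : ∀ x → ∑ (vecsOf xs k) (λ v → 𝟙 (P x ∧ allᵥ P v) * f (x ∷ v))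
               ≡ 𝟙 (P x) * ∑ (vecsOf xs k) (λ v → 𝟙 (allᵥ P v) * f (x ∷ v))
  factor x = trans
    (∑-cong (vecsOf xs k) (λ v → trans (cong (_* f (x ∷ v)) (𝟙-∧ (P x) (allᵥ P v))) (*-assoc (𝟙 (P x)) _ _)))
    (∑-*ˡ (vecsOf xs k) (𝟙 (P x)) _)

∑-vecsOf-reduce : {A B : Set} (xs : List A) (ys : List B) (r : A → B) (c : ℕ) →
  (∀ (f : B → ℕ) → ∑ xs (f ∘ r) ≡ c * ∑ ys f) →
  ∀ k (f : Vec B k → ℕ) → ∑ (vecsOf xs k) (f ∘ Vec.map r) ≡ c ^ k * ∑ (vecsOf ys k) f
∑-vecsOf-reduce xs ys r c reduce zero    f = sym (+-identityʳ (f [] + 0))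
∑-vecsOf-reduce xs ys r c reduce (suc k) f = begin
  ∑ (vecsOf xs (suc k)) (f ∘ Vec.map r)
    ≡⟨ ∑-vecsOf-suc xs k _ ⟩
  ∑ xs (λ x → ∑ (vecsOf xs k) (λ v → f (r x ∷ Vec.map r v)))
    ≡⟨ ∑-cong xs (λ x → ∑-vecsOf-reduce xs ys r c reduce k (λ w → f (r x ∷ w))) ⟩
  ∑ xs (λ x → c ^ k * ∑ (vecsOf ys k) (λ w → f (r x ∷ w)))
    ≡⟨ ∑-*ˡ xs (c ^ k) _ ⟩
  c ^ k * ∑ xs (λ x → ∑ (vecsOf ys k) (λ w → f (r x ∷ w)))
    ≡⟨ cong (c ^ k *_) (reduce (λ y → ∑ (vecsOf ys k) (λ w → f (y ∷ w)))) ⟩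
  c ^ k * (c * ∑ ys (λ y → ∑ (vecsOf ys k) (λ w → f (y ∷ w))))
    ≡⟨ *-assoc (c ^ k) c _ ⟨
  c ^ k * c * ∑ ys (λ y → ∑ (vecsOf ys k) (λ w → f (y ∷ w)))
    ≡⟨ cong₂ _*_ (*-comm (c ^ k) c) (sym (∑-vecsOf-suc ys k f)) ⟩
  c ^ suc k * ∑ (vecsOf ys (suc k)) f ∎

insertColumn : {A : Set} {n m : ℕ} → Fin (suc m) → Vec A n → Vec (Vec A m) n → Vec (Vec A (suc m)) n
insertColumn i = zipWith (λ x row → insertAt row i x)

∑-matrices-insertColumn : {A : Set} (xs : List A) (n m : ℕ) (i : Fin (suc m)) (f : Vec (Vec A (suc m)) n → ℕ) →
  ∑ (vecsOf (vecsOf xs (suc m)) n) f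
    ≡ ∑ (vecsOf xs n) (λ c → ∑ (vecsOf (vecsOf xs m) n) (λ R → f (insertColumn i c R)))
∑-matrices-insertColumn xs zero    m i f = cong (_+ 0) (sym (+-identityʳ (f [])))
∑-matrices-insertColumn xs (suc n) m i f = begin
  ∑ (vecsOf (vecsOf xs (suc m)) (suc n)) f
    ≡⟨ ∑-vecsOf-suc (vecsOf xs (suc m)) n f ⟩
  ∑ (vecsOf xs (suc m)) (λ row → ∑ (vecsOf (vecsOf xs (suc m)) n) (λ A → f (row ∷ A)))
    ≡⟨ ∑-vecsOf-insertAt xs m i _ ⟩
  ∑ xs (λ x → ∑ (vecsOf xs m) (λ w → ∑ (vecsOf (vecsOf xs (suc m)) n) (λ A → f (insertAt w i x ∷ A))))
    ≡⟨ ∑-cong xs (λ x → ∑-cong (vecsOf xs m) (λ w →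
         ∑-matrices-insertColumn xs n m i (λ A → f (insertAt w i x ∷ A)))) ⟩
  ∑ xs (λ x → ∑ (vecsOf xs m) (λ w → ∑ (vecsOf xs n) (λ c →
    ∑ (vecsOf (vecsOf xs m) n) (λ R → f (insertAt w i x ∷ insertColumn i c R)))))
    ≡⟨ ∑-cong xs (λ x → ∑-swap (vecsOf xs m) (vecsOf xs n) _) ⟩
  ∑ xs (λ x → ∑ (vecsOf xs n) (λ c → ∑ (vecsOf xs m) (λ w →
    ∑ (vecsOf (vecsOf xs m) n) (λ R → f (insertAt w i x ∷ insertColumn i c R)))))
    ≡⟨ ∑-cong xs (λ x → ∑-cong (vecsOf xs n) (λ c →
         sym (∑-vecsOf-suc (vecsOf xs m) n (λ R → f (insertColumn i (x ∷ c) R))))) ⟩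
  ∑ xs (λ x → ∑ (vecsOf xs n) (λ c → ∑ (vecsOf (vecsOf xs m) (suc n)) (λ R → f (insertColumn i (x ∷ c) R))))
    ≡⟨ ∑-vecsOf-suc xs n _ ⟨
  ∑ (vecsOf xs (suc n)) (λ c → ∑ (vecsOf (vecsOf xs m) (suc n)) (λ R → f (insertColumn i c R))) ∎

dot : {q r b : ℕ} → Vec (Fin q) b → Vec (Fin r) b → ℕ
dot row x = sum (toList (tabulate (λ k → toℕ (lookup row k) * toℕ (lookup x k))))

dot-insertAt : {q b : ℕ} (i : Fin (suc b)) (a : Fin q) (w : Vec (Fin q) b) (t : Fin q) (y : Vec (Fin q) b) →
  dot (insertAt w i a) (insertAt y i t) ≡ toℕ a * toℕ t + dot w y
dot-insertAt fzero    a w       t y       = refl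
dot-insertAt (fsuc i) a (b ∷ w) t (x ∷ y) = begin
  toℕ b * toℕ x + dot (insertAt w i a) (insertAt y i t) ≡⟨ cong (toℕ b * toℕ x +_) (dot-insertAt i a w t y) ⟩
  toℕ b * toℕ x + (toℕ a * toℕ t + dot w y)             ≡⟨ +-exchange (toℕ b * toℕ x) (toℕ a * toℕ t) (dot w y) ⟩
  toℕ a * toℕ t + (toℕ b * toℕ x + dot w y)             ∎
  where
  +-exchange : ∀ x y z → x + (y + z) ≡ y + (x + z)
  +-exchange = solve-∀

allᵥ-insertAt : {A : Set} {n : ℕ} (P : A → Bool) (v : Vec A n) (i : Fin (suc n)) (x : A) →
  allᵥ P (insertAt v i x) ≡ P x ∧ allᵥ P v
allᵥ-insertAt P v       fzero    x = refl
allᵥ-insertAt P (y ∷ v) (fsuc i) x = begin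
  P y ∧ allᵥ P (insertAt v i x) ≡⟨ cong (P y ∧_) (allᵥ-insertAt P v i x) ⟩
  P y ∧ (P x ∧ allᵥ P v)        ≡⟨ ∧-assoc (P y) (P x) _ ⟨
  (P y ∧ P x) ∧ allᵥ P v        ≡⟨ cong (_∧ allᵥ P v) (∧-comm (P y) (P x)) ⟩
  (P x ∧ P y) ∧ allᵥ P v        ≡⟨ ∧-assoc (P x) (P y) _ ⟩
  P x ∧ (P y ∧ allᵥ P v)        ∎

module RowOperations (q : ℕ) .{{_ : NonZero q}} where

  open Congruence q

  addMultiple : {m : ℕ} → ℕ → Vec (Fin q) m → Vec (Fin q) m → Vec (Fin q) m
  addMultiple e = zipWith (λ a o → (toℕ o + e * toℕ a) mod q)

  eliminate : {n m : ℕ} → ℕ → Vec (Fin q) n → Vec (Fin q) m → Mat q n m → Mat q n m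
  eliminate v c row = zipWith (λ cₖ → addMultiple (toℕ cₖ * v) row) c

  dot-addMultiple : {m : ℕ} (e : ℕ) (row w y : Vec (Fin q) m) →
    dot (addMultiple e row w) y ≋ dot w y + e * dot row y
  dot-addMultiple e []        []      []      = ≡⇒≋ (sym (*-zeroʳ e))
  dot-addMultiple e (a ∷ row) (o ∷ w) (x ∷ y) = trans
    (+-≋ (*-≋ (trans (≡⇒≋ (toℕ-mod (toℕ o + e * toℕ a) q)) (%-≋ _)) refl) (dot-addMultiple e row w y))
    (≡⇒≋ (regroup (toℕ o) e (toℕ a) (toℕ x) (dot w y) (dot row y)))
    where
    regroup : ∀ o e a x d d′ → (o + e * a) * x + (d + e * d′) ≡ o * x + d + e * (a * x + d′)
    regroup = solve-∀

  ∑-addMultiple : (m : ℕ) (e : ℕ) (row : Vec (Fin q) m) (f : Vec (Fin q) m → ℕ) →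
    ∑ (vecsOf (allFin q) m) (f ∘ addMultiple e row) ≡ ∑ (vecsOf (allFin q) m) f
  ∑-addMultiple m e = ∑-vecsOf-invariant (allFin q) _ (λ a → ∑-allFin-translate q (e * toℕ a)) m

  ∑-eliminate : (n m : ℕ) (v : ℕ) (c : Vec (Fin q) n) (row : Vec (Fin q) m) (f : Mat q n m → ℕ) →
    ∑ (vecsOf (vecsOf (allFin q) m) n) (f ∘ eliminate v c row) ≡ ∑ (vecsOf (vecsOf (allFin q) m) n) f
  ∑-eliminate n m v c row =
    ∑-vecsOf-invariant (vecsOf (allFin q) m) _ (λ cₖ → ∑-addMultiple m (toℕ cₖ * v) row) n c

  module Pivot (v : ℕ) (u : Fin q) (vu+1≋0 : v * toℕ u + 1 ≋ 0) where

    root : ℕ → Fin q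
    root R = (v * R) mod q

    toℕ-root : ∀ R → toℕ (root R) ≋ v * R
    toℕ-root R = trans (≡⇒≋ (toℕ-mod (v * R) q)) (%-≋ (v * R))

    root-solves : ∀ R → toℕ u * toℕ (root R) + R ≋ 0
    root-solves R = begin
      (toℕ u * toℕ (root R) + R) % q   ≡⟨ +-≋ (*-≋ (refl {x = toℕ u % q}) (toℕ-root R)) (refl {x = R % q}) ⟩
      (toℕ u * (v * R) + R) % q         ≡⟨ cong (_% q) (expand (toℕ u) v R) ⟩
      ((v * toℕ u + 1) * R) % q         ≡⟨ *-≋ vu+1≋0 (refl {x = R % q}) ⟩
      0 % q                             ∎
      where
      expand : ∀ u v R → u * (v * R) + R ≡ (v * u + 1) * R
      expand = solve-∀

    root-unique : ∀ R t → toℕ u * toℕ t + R ≋ 0 → t ≡ root R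
    root-unique R t ut+R≋0 = toℕ-injective (begin
      toℕ t            ≡⟨ m<n⇒m%n≡m (toℕ<n t) ⟨
      toℕ t % q        ≡⟨ +-cancelʳ-≋ {c = v * toℕ u * toℕ t} t≋vR ⟩
      (v * R) % q      ≡⟨ toℕ-mod (v * R) q ⟨
      toℕ (root R)     ∎)
      where
      t≋vR : toℕ t + v * toℕ u * toℕ t ≋ v * R + v * toℕ u * toℕ t
      t≋vR = begin
        (toℕ t + v * toℕ u * toℕ t) % q   ≡⟨ cong (_% q) (factorˡ (toℕ t) v (toℕ u)) ⟩
        ((v * toℕ u + 1) * toℕ t) % q     ≡⟨ *-≋ vu+1≋0 (refl {x = toℕ t % q}) ⟩
        0 % q                             ≡⟨ cong (_% q) (*-zeroʳ v) ⟨
        (v * 0) % q                       ≡⟨ *-≋ (refl {x = v % q}) ut+R≋0 ⟨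
        (v * (toℕ u * toℕ t + R)) % q     ≡⟨ cong (_% q) (factorʳ (toℕ t) v (toℕ u) R) ⟨
        (v * R + v * toℕ u * toℕ t) % q   ∎
        where
        factorˡ : ∀ t v u → t + v * u * t ≡ (v * u + 1) * t
        factorˡ = solve-∀
        factorʳ : ∀ t v u R → v * R + v * u * t ≡ v * (u * t + R)
        factorʳ = solve-∀

    isSolution-root : {n m : ℕ} (i : Fin (suc m)) (c : Vec (Fin q) n) (O : Mat q n m) (row y : Vec (Fin q) m) →
      isSolution (insertColumn i c O) (insertAt y i (root (dot row y))) ≡ isSolution (eliminate v c row O) y
    isSolution-root i []       []      row y = refl
    isSolution-root i (cₖ ∷ c) (w ∷ O) row y =
      cong₂ _∧_ (divB-cong-% q first-row) (isSolution-root i c O row y)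
      where
      R = dot row y
      first-row : dot (insertAt w i cₖ) (insertAt y i (root R)) ≋ dot (addMultiple (toℕ cₖ * v) row w) y
      first-row = begin
        dot (insertAt w i cₖ) (insertAt y i (root R)) % q  ≡⟨ cong (_% q) (dot-insertAt i cₖ w (root R) y) ⟩
        (toℕ cₖ * toℕ (root R) + dot w y) % q
          ≡⟨ +-≋ (*-≋ (refl {x = toℕ cₖ % q}) (toℕ-root R)) (refl {x = dot w y % q}) ⟩
        (toℕ cₖ * (v * R) + dot w y) % q                    ≡⟨ cong (_% q) (rearrange (toℕ cₖ) v R (dot w y)) ⟩
        (dot w y + toℕ cₖ * v * R) % q                      ≡⟨ dot-addMultiple (toℕ cₖ * v) row w y ⟨
        dot (addMultiple (toℕ cₖ * v) row w) y % q          ∎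
        where
        rearrange : ∀ c v R d → c * (v * R) + d ≡ d + c * v * R
        rearrange = solve-∀

    numSolutions-pivot : {n m : ℕ} (i : Fin (suc m)) (r : Fin (suc n)) (c : Vec (Fin q) n) (O : Mat q n m) (row : Vec (Fin q) m) →
      numSolutions (insertAt (insertColumn i c O) r (insertAt row i u)) ≡ numSolutions (eliminate v c row O)
    numSolutions-pivot {n} {m} i r c O row = begin
      numSolutions A
        ≡⟨ count≡∑𝟙 (isSolution A) (vecsOf (allFin q) (suc m)) ⟩
      ∑ (vecsOf (allFin q) (suc m)) (𝟙 ∘ isSolution A)
        ≡⟨ ∑-vecsOf-insertAt (allFin q) m i _ ⟩
      ∑ (allFin q) (λ t → ∑ (vecsOf (allFin q) m) (λ y → 𝟙 (isSolution A (insertAt y i t))))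
        ≡⟨ ∑-swap (allFin q) (vecsOf (allFin q) m) _ ⟩
      ∑ (vecsOf (allFin q) m) (λ y → ∑ (allFin q) (λ t → 𝟙 (isSolution A (insertAt y i t))))
        ≡⟨ ∑-cong (vecsOf (allFin q) m) solve-pivot-coordinate ⟩
      ∑ (vecsOf (allFin q) m) (𝟙 ∘ isSolution (eliminate v c row O))
        ≡⟨ count≡∑𝟙 (isSolution (eliminate v c row O)) (vecsOf (allFin q) m) ⟨
      numSolutions (eliminate v c row O) ∎
      where
      A = insertAt (insertColumn i c O) r (insertAt row i u)
      pivotRow : Vec (Fin q) m → Fin q → Bool
      pivotRow y t = divB q (toℕ u * toℕ t + dot row y)
      otherRows : Vec (Fin q) m → Fin q → Bool
      otherRows y t = isSolution (insertColumn i c O) (insertAt y i t)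
      split : ∀ y t → isSolution A (insertAt y i t) ≡ pivotRow y t ∧ otherRows y t
      split y t = trans (allᵥ-insertAt (λ rw → divB q (dot rw (insertAt y i t))) (insertColumn i c O) r (insertAt row i u))
                        (cong (λ z → divB q z ∧ otherRows y t) (dot-insertAt i u row t y))
      off-root : ∀ y t → t ≢ root (dot row y) → 𝟙 (pivotRow y t ∧ otherRows y t) ≡ 0
      off-root y t t≢root with pivotRow y t in eq
      ... | true  = contradiction (root-unique (dot row y) t (∣⇒≋0 (divB⇒∣ q _ eq))) t≢root
      ... | false = refl
      solve-pivot-coordinate : ∀ y → ∑ (allFin q) (λ t → 𝟙 (isSolution A (insertAt y i t)))
                                      ≡ 𝟙 (isSolution (eliminate v c row O) y)
      solve-pivot-coordinate y = begin
        ∑ (allFin q) (λ t → 𝟙 (isSolution A (insertAt y i t)))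
          ≡⟨ ∑-cong (allFin q) (λ t → cong 𝟙 (split y t)) ⟩
        ∑ (allFin q) (λ t → 𝟙 (pivotRow y t ∧ otherRows y t))
          ≡⟨ ∑-allFin-point q _ (root (dot row y)) (off-root y) ⟩
        𝟙 (pivotRow y (root (dot row y)) ∧ otherRows y (root (dot row y)))
          ≡⟨ cong (λ b → 𝟙 (b ∧ otherRows y (root (dot row y)))) (∣⇒divB q _ (≋0⇒∣ (root-solves (dot row y)))) ⟩
        𝟙 (otherRows y (root (dot row y)))
          ≡⟨ cong 𝟙 (isSolution-root i c O row y) ⟩
        𝟙 (isSolution (eliminate v c row O) y) ∎

true-iff⇒≡ : ∀ {a b} → (a ≡ true → b ≡ true) → (b ≡ true → a ≡ true) → a ≡ b
true-iff⇒≡ {true}  {true}  a⇒b b⇒a = refl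
true-iff⇒≡ {true}  {false} a⇒b b⇒a = sym (a⇒b refl)
true-iff⇒≡ {false} {true}  a⇒b b⇒a = b⇒a refl
true-iff⇒≡ {false} {false} a⇒b b⇒a = refl

all-tabulate⁻ : {A : Set} {n : ℕ} (g : A → Bool) (f : Fin n → A) →
  all g (List.tabulate f) ≡ true → ∀ k → g (f k) ≡ true
all-tabulate⁻ g f all≡true fzero    = ∧-conicalˡ _ _ all≡true
all-tabulate⁻ g f all≡true (fsuc k) = all-tabulate⁻ g (f ∘ fsuc) (∧-conicalʳ _ _ all≡true) k

all-tabulate⁺ : {A : Set} {n : ℕ} (g : A → Bool) (f : Fin n → A) →
  (∀ k → g (f k) ≡ true) → all g (List.tabulate f) ≡ true
all-tabulate⁺ {n = zero}  g f gf = refl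
all-tabulate⁺ {n = suc n} g f gf = cong₂ _∧_ (gf fzero) (all-tabulate⁺ g (f ∘ fsuc) (gf ∘ fsuc))

any-tabulate⁻ : {A : Set} {n : ℕ} (g : A → Bool) (f : Fin n → A) →
  any g (List.tabulate f) ≡ true → Σ (Fin n) (λ k → g (f k) ≡ true)
any-tabulate⁻ {n = suc n} g f any≡true with g (f fzero) in eq
... | true  = fzero , eq
... | false = let (k , gfk) = any-tabulate⁻ g (f ∘ fsuc) any≡true in fsuc k , gfk

any-tabulate⁺ : {A : Set} {n : ℕ} (g : A → Bool) (f : Fin n → A) (k : Fin n) →
  g (f k) ≡ true → any g (List.tabulate f) ≡ true
any-tabulate⁺ g f fzero    gfk rewrite gfk = refl
any-tabulate⁺ g f (fsuc k) gfk with g (f fzero)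
... | true  = refl
... | false = any-tabulate⁺ g (f ∘ fsuc) k gfk

allᵥ⁻ : {A : Set} {n : ℕ} (P : A → Bool) (v : Vec A n) → allᵥ P v ≡ true → ∀ k → P (lookup v k) ≡ true
allᵥ⁻ P (x ∷ v) all≡true fzero    = ∧-conicalˡ _ _ all≡true
allᵥ⁻ P (x ∷ v) all≡true (fsuc k) = allᵥ⁻ P v (∧-conicalʳ _ _ all≡true) k

allᵥ⁺ : {A : Set} {n : ℕ} (P : A → Bool) (v : Vec A n) → (∀ k → P (lookup v k) ≡ true) → allᵥ P v ≡ true
allᵥ⁺ P []      Pv = refl
allᵥ⁺ P (x ∷ v) Pv = cong₂ _∧_ (Pv fzero) (allᵥ⁺ P v (Pv ∘ fsuc))

allᵥ-cong : {A : Set} {k : ℕ} {P Q : A → Bool} → (∀ x → P x ≡ Q x) → (v : Vec A k) → allᵥ P v ≡ allᵥ Q v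
allᵥ-cong P≗Q []      = refl
allᵥ-cong P≗Q (x ∷ v) = cong₂ _∧_ (P≗Q x) (allᵥ-cong P≗Q v)

not-allᵥ≡any-not : {A : Set} {n : ℕ} (P : A → Bool) (v : Vec A n) → not (allᵥ P v) ≡ any (not ∘ P) (toList v)
not-allᵥ≡any-not P []      = refl
not-allᵥ≡any-not P (x ∷ v) with P x
... | true  = not-allᵥ≡any-not P v
... | false = refl

any-toList⁺ : {A : Set} {n : ℕ} (P : A → Bool) (v : Vec A n) (k : Fin n) →
  P (lookup v k) ≡ true → any P (toList v) ≡ true
any-toList⁺ P (x ∷ v) fzero    Px rewrite Px = refl
any-toList⁺ P (x ∷ v) (fsuc k) Pv with P x
... | true  = refl
... | false = any-toList⁺ P v k Pv

not-allᵥ⁻ : {A : Set} {n : ℕ} (P : A → Bool) (v : Vec A n) →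
  not (allᵥ P v) ≡ true → Σ (Fin n) (λ k → P (lookup v k) ≡ false)
not-allᵥ⁻ P (x ∷ v) ¬all with P x in eq
... | false = fzero , eq
... | true  = let (k , ¬Pk) = not-allᵥ⁻ P v ¬all in fsuc k , ¬Pk

prefixAll : {A : Set} {n : ℕ} → (A → Bool) → ℕ → Vec A n → Bool
prefixAll P zero    w       = true
prefixAll P (suc i) []      = true
prefixAll P (suc i) (a ∷ w) = P a ∧ prefixAll P i w

prefixAll⁻ : {A : Set} {n : ℕ} (P : A → Bool) (i : ℕ) (w : Vec A n) →
  prefixAll P i w ≡ true → ∀ k → toℕ k < i → P (lookup w k) ≡ true
prefixAll⁻ P (suc i) (a ∷ w) pre fzero    _         = ∧-conicalˡ _ _ pre
prefixAll⁻ P (suc i) (a ∷ w) pre (fsuc k) (s<s k<i) = prefixAll⁻ P i w (∧-conicalʳ _ _ pre) k k<i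

prefixAll⁺ : {A : Set} {n : ℕ} (P : A → Bool) (i : ℕ) (w : Vec A n) →
  (∀ k → toℕ k < i → P (lookup w k) ≡ true) → prefixAll P i w ≡ true
prefixAll⁺ P zero    w       Pw = refl
prefixAll⁺ P (suc i) []      Pw = refl
prefixAll⁺ P (suc i) (a ∷ w) Pw = cong₂ _∧_ (Pw fzero z<s) (prefixAll⁺ P i w (λ k k<i → Pw (fsuc k) (s<s k<i)))

prefixAll-full : {A : Set} {n : ℕ} (P : A → Bool) (w : Vec A n) → prefixAll P n w ≡ allᵥ P w
prefixAll-full P []      = refl
prefixAll-full P (a ∷ w) = cong (P a ∧_) (prefixAll-full P w)

prefixAll-insertAt : {A : Set} {n : ℕ} (P : A → Bool) (i : Fin (suc n)) (w : Vec A n) (a : A) →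
  prefixAll P (toℕ i) (insertAt w i a) ≡ prefixAll P (toℕ i) w
prefixAll-insertAt P fzero    w       a = refl
prefixAll-insertAt P (fsuc i) (x ∷ w) a = cong (P x ∧_) (prefixAll-insertAt P i w a)

divisibleBy : ℕ → {q : ℕ} → Fin q → Bool
divisibleBy p x = divB p (toℕ x)

<⇒<ᵇ≡true : ∀ {a b} → a < b → (a <ᵇ b) ≡ true
<⇒<ᵇ≡true a<b = Equivalence.to T-≡ (<⇒<ᵇ a<b)

firstColsDiv≡allRows : (p : ℕ) {q a b : ℕ} (i : ℕ) (A : Mat q a b) →
  firstColsDiv p i A ≡ allᵥ (prefixAll (divisibleBy p) i) A
firstColsDiv≡allRows p {b = b} i A = true-iff⇒≡ cols⇒rows rows⇒cols
  where
  columnTest : Fin b → Bool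
  columnTest k = not (toℕ k <ᵇ i) ∨ colDivBy p A k
  cols⇒rows : firstColsDiv p i A ≡ true → allᵥ (prefixAll (divisibleBy p) i) A ≡ true
  cols⇒rows cols = allᵥ⁺ _ A (λ r → prefixAll⁺ (divisibleBy p) i (lookup A r) (λ k k<i →
    allᵥ⁻ (λ row → divisibleBy p (lookup row k)) A
      (subst (λ z → not z ∨ colDivBy p A k ≡ true) (<⇒<ᵇ≡true k<i) (all-tabulate⁻ columnTest id cols k)) r))
  rows⇒cols : allᵥ (prefixAll (divisibleBy p) i) A ≡ true → firstColsDiv p i A ≡ true
  rows⇒cols rows = all-tabulate⁺ columnTest id column
    where
    column : ∀ k → columnTest k ≡ true
    column k with toℕ k <ᵇ i in k<ᵇi
    ... | false = refl
    ... | true  = allᵥ⁺ (λ row → divisibleBy p (lookup row k)) A (λ r →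
          prefixAll⁻ (divisibleBy p) i (lookup A r) (allᵥ⁻ _ A rows r) k
            (<ᵇ⇒< (toℕ k) i (Equivalence.from T-≡ k<ᵇi)))

allRows-insertColumn : {A : Set} {n m : ℕ} (P : A → Bool) (i : Fin (suc m)) (c : Vec A n) (R : Vec (Vec A m) n) →
  allᵥ (prefixAll P (toℕ i)) (insertColumn i c R) ≡ allᵥ (prefixAll P (toℕ i)) R
allRows-insertColumn P i []      []      = refl
allRows-insertColumn P i (x ∷ c) (w ∷ R) = cong₂ _∧_ (prefixAll-insertAt P i w x) (allRows-insertColumn P i c R)

colDivBy-insertColumn : (p : ℕ) {q n m : ℕ} (i : Fin (suc m)) (c : Vec (Fin q) n) (R : Mat q n m) →
  colDivBy p (insertColumn i c R) i ≡ allᵥ (divisibleBy p) c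
colDivBy-insertColumn p i []      []      = refl
colDivBy-insertColumn p i (x ∷ c) (w ∷ R) =
  cong₂ _∧_ (cong (divisibleBy p) (insertAt-lookup w i x)) (colDivBy-insertColumn p i c R)

nondivisibleColumn-insertColumn : (p : ℕ) {q n m : ℕ} (i : Fin (suc m)) (c : Vec (Fin q) n) (R : Mat q n m) →
  any (λ k → (toℕ k ≡ᵇ toℕ i) ∧ not (colDivBy p (insertColumn i c R) k)) (allFin (suc m))
    ≡ not (allᵥ (divisibleBy p) c)
nondivisibleColumn-insertColumn p {m = m} i c R = true-iff⇒≡ some⇒new new⇒some
  where
  test : Fin (suc m) → Bool
  test k = (toℕ k ≡ᵇ toℕ i) ∧ not (colDivBy p (insertColumn i c R) k)
  newColumn : not (colDivBy p (insertColumn i c R) i) ≡ not (allᵥ (divisibleBy p) c)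
  newColumn = cong not (colDivBy-insertColumn p i c R)
  some⇒new : any test (allFin (suc m)) ≡ true → not (allᵥ (divisibleBy p) c) ≡ true
  some⇒new some with any-tabulate⁻ test id some
  ... | k , test-k = trans (sym newColumn) (subst (λ k → not (colDivBy p (insertColumn i c R) k) ≡ true) k≡i
                                                  (∧-conicalʳ _ _ test-k))
    where
    k≡i : k ≡ i
    k≡i = toℕ-injective (≡ᵇ⇒≡ (toℕ k) (toℕ i) (Equivalence.from T-≡ (∧-conicalˡ _ _ test-k)))
  new⇒some : not (allᵥ (divisibleBy p) c) ≡ true → any test (allFin (suc m)) ≡ true
  new⇒some new = any-tabulate⁺ test id i
    (cong₂ _∧_ (Equivalence.to T-≡ (≡⇒≡ᵇ (toℕ i) (toℕ i) refl)) (trans newColumn new))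

relPrime-insertColumn : (p : ℕ) {q n m : ℕ} (i : Fin (suc m)) (c : Vec (Fin q) n) (R : Mat q n m) →
  not (allᵥ (divisibleBy p) c) ≡ true → relPrime p (insertColumn i c R) ≡ true
relPrime-insertColumn p i c R ¬all with not-allᵥ⁻ (divisibleBy p) c ¬all
... | r , ¬p∣cᵣ = any-toList⁺ (λ row → any (not ∘ divisibleBy p) (toList row)) (insertColumn i c R) r
  (subst (λ row → any (not ∘ divisibleBy p) (toList row) ≡ true) (sym (lookup-zipWith _ r c R))
    (any-toList⁺ (not ∘ divisibleBy p) (insertAt (lookup R r) i (lookup c r)) i
      (subst (λ x → not (divisibleBy p x) ≡ true) (sym (insertAt-lookup (lookup R r) i (lookup c r))) (cong not ¬p∣cᵣ))))

Etilde-test-insertColumn : (p : ℕ) {q n m : ℕ} (i : Fin (suc m)) (c : Vec (Fin q) n) (R : Mat q n m) (H : Bool) →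
  (relPrime p (insertColumn i c R) ∧ firstColsDiv p (toℕ i) (insertColumn i c R)
     ∧ any (λ k → (toℕ k ≡ᵇ toℕ i) ∧ not (colDivBy p (insertColumn i c R) k)) (allFin (suc m)) ∧ H)
  ≡ not (allᵥ (divisibleBy p) c) ∧ (allᵥ (prefixAll (divisibleBy p) (toℕ i)) R ∧ H)
Etilde-test-insertColumn p i c R H
  rewrite nondivisibleColumn-insertColumn p i c R | firstColsDiv≡allRows p (toℕ i) (insertColumn i c R)
        | allRows-insertColumn (divisibleBy p) i c R
  with not (allᵥ (divisibleBy p) c) in ¬all
... | true  rewrite relPrime-insertColumn p i c R ¬all = refl
... | false = trans (cong (relPrime p (insertColumn i c R) ∧_) (∧-zeroʳ _)) (∧-zeroʳ _)

module _ {p q : ℕ} .{{_ : NonZero p}} .{{_ : NonZero q}} (p∣q : p ∣ q) where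

  open RowOperations q

  prefixAll-addMultiple : {m : ℕ} (i e : ℕ) (row w : Vec (Fin q) m) → prefixAll (divisibleBy p) i row ≡ true →
    prefixAll (divisibleBy p) i (addMultiple e row w) ≡ prefixAll (divisibleBy p) i w
  prefixAll-addMultiple zero    e row       w       _   = refl
  prefixAll-addMultiple (suc i) e []        []      _   = refl
  prefixAll-addMultiple (suc i) e (a ∷ row) (o ∷ w) pre =
    cong₂ _∧_ (divB-cong-% p entry) (prefixAll-addMultiple i e row w (∧-conicalʳ _ _ pre))
    where
    entry : toℕ ((toℕ o + e * toℕ a) mod q) % p ≡ toℕ o % p
    entry = begin
      toℕ ((toℕ o + e * toℕ a) mod q) % p  ≡⟨ cong (_% p) (toℕ-mod _ q) ⟩
      (toℕ o + e * toℕ a) % q % p          ≡⟨ m∣n⇒o%n%m≡o%m p q _ p∣q ⟩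
      (toℕ o + e * toℕ a) % p
        ≡⟨ %-remove-+ʳ (toℕ o) (∣n⇒∣m*n e (divB⇒∣ p _ (∧-conicalˡ _ _ pre))) ⟩
      toℕ o % p                            ∎

  allRows-eliminate : {n m : ℕ} (i v : ℕ) (c : Vec (Fin q) n) (row : Vec (Fin q) m) (O : Mat q n m) →
    prefixAll (divisibleBy p) i row ≡ true →
    allᵥ (prefixAll (divisibleBy p) i) (eliminate v c row O) ≡ allᵥ (prefixAll (divisibleBy p) i) O
  allRows-eliminate i v []       row []      pre = refl
  allRows-eliminate i v (cₖ ∷ c) row (w ∷ O) pre =
    cong₂ _∧_ (prefixAll-addMultiple i (toℕ cₖ * v) row w pre) (allRows-eliminate i v c row O pre)

module _ {p : ℕ} (p-prime : Prime p) where

  coprime-prime : ∀ {a} → ¬ p ∣ a → Coprime a p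
  coprime-prime {a} p∤a (d∣a , d∣p) with prime⇒irreducible p-prime d∣p
  ... | inj₁ d≡1    = d≡1
  ... | inj₂ refl   = contradiction d∣a p∤a

  coprime-prime-power : ∀ {a} → ¬ p ∣ a → ∀ k → Coprime a (p ^ k)
  coprime-prime-power p∤a zero    (d∣a , d∣1)  = ∣1⇒≡1 d∣1
  coprime-prime-power p∤a (suc k) {d} (d∣a , d∣pk) =
    coprime-prime-power p∤a k (d∣a , coprime-divisor d⊥p d∣pk)
    where
    d⊥p : Coprime d p
    d⊥p (e∣d , e∣p) = coprime-prime p∤a (∣-trans e∣d d∣a , e∣p)

  coprime?-prime-power : ∀ s a → ⌊ coprime? a (p ^ suc s) ⌋ ≡ not (divB p a)
  coprime?-prime-power s a with coprime? a (p ^ suc s) | p ∣? a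
  ... | yes a⊥q | yes p∣a =
    contradiction (a⊥q (p∣a , ∣m⇒∣m*n (p ^ s) (∣-refl {p}))) (λ p≡1 → ¬prime[1] (subst Prime p≡1 p-prime))
  ... | yes _   | no  _   = refl
  ... | no  _   | yes _   = refl
  ... | no ¬a⊥q | no p∤a  = contradiction (λ {d} → coprime-prime-power p∤a (suc s) {d}) ¬a⊥q

  -- ℕ has no negation, so we produce v ≡ -u⁻¹ rather than u⁻¹.
  negated-inverse : ∀ s u → ¬ p ∣ u → .{{_ : NonZero (p ^ suc s)}} →
    Σ ℕ (λ v → (v * u + 1) % (p ^ suc s) ≡ 0 % (p ^ suc s))
  negated-inverse s u p∤u with coprime-Bézout (coprime-prime-power p∤u (suc s))
  ... | Bézout.+- x y 1+yq≡xu = (q ∸ 1) * x , (begin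
    ((q ∸ 1) * x * u + 1) % q     ≡⟨ cong (λ z → (z + 1) % q) (*-assoc (q ∸ 1) x u) ⟩
    ((q ∸ 1) * (x * u) + 1) % q   ≡⟨ +-≋ (*-≋ (refl {x = (q ∸ 1) % q}) xu≋1) (refl {x = 1 % q}) ⟩
    ((q ∸ 1) * 1 + 1) % q         ≡⟨ cong (λ z → (z + 1) % q) (*-identityʳ (q ∸ 1)) ⟩
    (q ∸ 1 + 1) % q               ≡⟨ cong (_% q) (m∸n+n≡m (>-nonZero⁻¹ q)) ⟩
    q % q                         ≡⟨ n%n≡0 q ⟩
    0                             ≡⟨ 0%q≡0 ⟨
    0 % q                         ∎)
    where
    q = p ^ suc s
    open Congruence q
    xu≋1 : x * u ≋ 1
    xu≋1 = trans (cong (_% q) (sym 1+yq≡xu)) (%-remove-+ʳ 1 {d = q} (n∣m*n y))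
  ... | Bézout.-+ x y xu+1≡yq = x , (begin
    (x * u + 1) % q   ≡⟨ cong (_% q) (trans (+-comm (x * u) 1) xu+1≡yq) ⟩
    (y * q) % q       ≡⟨ m*n%n≡0 y q ⟩
    0                 ≡⟨ 0%q≡0 ⟨
    0 % q             ∎)
    where
    q = p ^ suc s
    open Congruence q

-- The number of n-tuples over a list with an entry satisfying a test, in terms of the length L of the
-- list and the numbers c and c̄ of its elements passing and failing the test.
countAny : (L c c̄ : ℕ) → ℕ → ℕ
countAny L c c̄ zero    = 0
countAny L c c̄ (suc n) = c * L ^ n + c̄ * countAny L c c̄ n

∑-vecsOf-any : {A : Set} (xs : List A) (g : A → Bool) (n : ℕ) →
  ∑ (vecsOf xs n) (λ v → 𝟙 (any g (toList v)))
    ≡ countAny (length xs) (∑ xs (𝟙 ∘ g)) (∑ xs (𝟙 ∘ not ∘ g)) n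
∑-vecsOf-any xs g zero    = refl
∑-vecsOf-any xs g (suc n) = begin
  ∑ (vecsOf xs (suc n)) (λ v → 𝟙 (any g (toList v)))
    ≡⟨ ∑-vecsOf-suc xs n _ ⟩
  ∑ xs (λ x → ∑ (vecsOf xs n) (λ v → 𝟙 (g x ∨ any g (toList v))))
    ≡⟨ ∑-cong xs byHead ⟩
  ∑ xs (λ x → 𝟙 (g x) * length xs ^ n + 𝟙 (not (g x)) * countAny (length xs) c c̄ n)
    ≡⟨ ∑-+ xs _ _ ⟩
  ∑ xs (λ x → 𝟙 (g x) * length xs ^ n) + ∑ xs (λ x → 𝟙 (not (g x)) * countAny (length xs) c c̄ n)
    ≡⟨ cong₂ _+_ (∑-*ʳ xs _ (𝟙 ∘ g)) (∑-*ʳ xs _ (𝟙 ∘ not ∘ g)) ⟩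
  c * length xs ^ n + c̄ * countAny (length xs) c c̄ n ∎
  where
  c  = ∑ xs (𝟙 ∘ g)
  c̄ = ∑ xs (𝟙 ∘ not ∘ g)
  byHead : ∀ x → ∑ (vecsOf xs n) (λ v → 𝟙 (g x ∨ any g (toList v)))
                   ≡ 𝟙 (g x) * length xs ^ n + 𝟙 (not (g x)) * countAny (length xs) c c̄ n
  byHead x with g x
  ... | true  = trans (length-vecsOf xs n) (sym (trans (+-identityʳ _) (+-identityʳ _)))
  ... | false = trans (∑-vecsOf-any xs g n) (sym (+-identityʳ _))

module _ {p : ℕ} (p-prime : Prime p) (s : ℕ) where

  private
    q = p ^ suc s
    instance
      p≢0 : NonZero p
      p≢0 = prime⇒nonZero p-prime
      q≢0 : NonZero q
      q≢0 = m^n≢0 p (suc s)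

  -- x ↦ x is a bijection between ℤ_q and {1, …, q} except that 0 ↦ q, and both are multiples of p.
  ∑-residues≡∑-1-to-q : (h : Bool → ℕ) →
    ∑ (allFin q) (λ x → h (not (divisibleBy p x))) ≡ ∑ (map suc (upTo q)) (λ a → h ⌊ coprime? a q ⌋)
  ∑-residues≡∑-1-to-q h = begin
    ∑ (allFin q) (λ x → h (not (divisibleBy p x)))   ≡⟨ ∑-allFin-mod q _ ⟩
    ∑< q (λ a → h (unit (toℕ (a mod q))))            ≡⟨ ∑<-cong q (λ a a<q → cong (h ∘ unit) (toℕ-mod-< a<q)) ⟩
    ∑< q (h ∘ unit)                                  ≡⟨ ∑<-rotate q (h ∘ unit) (cong h unit-q≡unit-0) ⟨
    ∑< q (h ∘ unit ∘ suc)
      ≡⟨ ∑<-cong q (λ a _ → cong h (sym (coprime?-prime-power p-prime s (suc a)))) ⟩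
    ∑< q (λ a → h ⌊ coprime? (suc a) q ⌋)            ≡⟨ ∑-applyUpTo id q _ ⟨
    ∑ (upTo q) (λ a → h ⌊ coprime? (suc a) q ⌋)      ≡⟨ ∑-map suc (upTo q) _ ⟨
    ∑ (map suc (upTo q)) (λ a → h ⌊ coprime? a q ⌋)  ∎
    where
    unit : ℕ → Bool
    unit a = not (divB p a)
    unit-q≡unit-0 : unit q ≡ unit 0
    unit-q≡unit-0 = cong not (trans (∣⇒divB p q (∣m⇒∣m*n (p ^ s) (∣-refl {p}))) (sym (∣⇒divB p 0 (p ∣0))))

  count-nondivisible-columns : ∀ n → ∑ (vecsOf (allFin q) n) (λ c → 𝟙 (not (allᵥ (divisibleBy p) c))) ≡ φ n q
  count-nondivisible-columns n = begin
    ∑ (vecsOf (allFin q) n) (λ c → 𝟙 (not (allᵥ (divisibleBy p) c)))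
      ≡⟨ ∑-cong (vecsOf (allFin q) n) (λ c → cong 𝟙 (not-allᵥ≡any-not (divisibleBy p) c)) ⟩
    ∑ (vecsOf (allFin q) n) (λ c → 𝟙 (any (not ∘ divisibleBy p) (toList c)))
      ≡⟨ ∑-vecsOf-any (allFin q) (not ∘ divisibleBy p) n ⟩
    countAny (length (allFin q)) (∑ (allFin q) (𝟙 ∘ not ∘ divisibleBy p))
             (∑ (allFin q) (𝟙 ∘ not ∘ not ∘ divisibleBy p)) n
      ≡⟨ cong₂ (λ L cc → countAny L (proj₁ cc) (proj₂ cc) n) sameLength
               (cong₂ _,_ (∑-residues≡∑-1-to-q 𝟙) (∑-residues≡∑-1-to-q (𝟙 ∘ not))) ⟩
    countAny (length (map suc (upTo q))) (∑ (map suc (upTo q)) (λ a → 𝟙 ⌊ coprime? a q ⌋))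
             (∑ (map suc (upTo q)) (λ a → 𝟙 (not ⌊ coprime? a q ⌋))) n
      ≡⟨ ∑-vecsOf-any (map suc (upTo q)) (λ a → ⌊ coprime? a q ⌋) n ⟨
    ∑ (vecsOf (map suc (upTo q)) n) (λ v → 𝟙 (any (λ a → ⌊ coprime? a q ⌋) (toList v)))
      ≡⟨ count≡∑𝟙 _ (vecsOf (map suc (upTo q)) n) ⟨
    φ n q ∎
    where
    sameLength : length (allFin q) ≡ length (map suc (upTo q))
    sameLength = trans (length-allFin q) (sym (trans (length-map suc (upTo q)) (length-upTo q)))

insertColumn-insertAt : {A : Set} {n m : ℕ} (i : Fin (suc m)) (r : Fin (suc n)) (c : Vec A n) (u : A)
  (O : Vec (Vec A m) n) (row : Vec A m) →
  insertColumn i (insertAt c r u) (insertAt O r row) ≡ insertAt (insertColumn i c O) r (insertAt row i u)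
insertColumn-insertAt i fzero    c       u O       row = refl
insertColumn-insertAt i (fsuc r) (x ∷ c) u (w ∷ O) row = cong (insertAt w i x ∷_) (insertColumn-insertAt i r c u O row)

module Counting {p : ℕ} (p-prime : Prime p) (s : ℕ) where

  q′ = p ^ s
  q  = p * q′

  instance
    p≢0 : NonZero p
    p≢0 = prime⇒nonZero p-prime
    q′≢0 : NonZero q′
    q′≢0 = m^n≢0 p s
    q≢0 : NonZero q
    q≢0 = m*n≢0 p q′

  open RowOperations q

  Vecs : (k : ℕ) → List (Vec (Fin q) k)
  Vecs k = vecsOf (allFin q) k

  Mats : (n m : ℕ) → List (Mat q n m)
  Mats n m = vecsOf (Vecs m) n

  firstDiv : {m : ℕ} → ℕ → Vec (Fin q) m → Bool
  firstDiv i = prefixAll (divisibleBy p) i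

  count-multiples : ∑ (allFin q) (𝟙 ∘ divisibleBy p) ≡ q′
  count-multiples = begin
    ∑ (allFin q) (𝟙 ∘ divisibleBy p)            ≡⟨ ∑-cong (allFin q) (λ a → *-identityʳ _) ⟨
    ∑ (allFin q) (λ a → 𝟙 (divisibleBy p a) * 1) ≡⟨ ∑-allFin-multiples p q′ (λ _ → 1) ⟩
    ∑ (allFin q′) (λ _ → 1)                     ≡⟨ ∑-const (allFin q′) 1 ⟩
    length (allFin q′) * 1                      ≡⟨ *-identityʳ _ ⟩
    length (allFin q′)                          ≡⟨ length-allFin q′ ⟩
    q′                                          ∎

  count-firstDiv : ∀ i m → i ≤ m → ∑ (Vecs m) (𝟙 ∘ firstDiv i) ≡ q′ ^ i * q ^ (m ∸ i)
  count-firstDiv zero m _ =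
    trans (length-vecsOf (allFin q) m) (trans (cong (_^ m) (length-allFin q)) (sym (*-identityˡ _)))
  count-firstDiv (suc i) (suc m) (s≤s i≤m) = begin
    ∑ (Vecs (suc m)) (𝟙 ∘ firstDiv (suc i))
      ≡⟨ ∑-vecsOf-suc (allFin q) m _ ⟩
    ∑ (allFin q) (λ a → ∑ (Vecs m) (λ w → 𝟙 (divisibleBy p a ∧ firstDiv i w)))
      ≡⟨ ∑-cong (allFin q) (λ a → ∑-𝟙-∧ (Vecs m) (divisibleBy p a) (firstDiv i)) ⟩
    ∑ (allFin q) (λ a → 𝟙 (divisibleBy p a) * ∑ (Vecs m) (𝟙 ∘ firstDiv i))
      ≡⟨ ∑-*ʳ (allFin q) _ _ ⟩
    ∑ (allFin q) (𝟙 ∘ divisibleBy p) * ∑ (Vecs m) (𝟙 ∘ firstDiv i)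
      ≡⟨ cong₂ _*_ count-multiples (count-firstDiv i m i≤m) ⟩
    q′ * (q′ ^ i * q ^ (m ∸ i))
      ≡⟨ *-assoc q′ _ _ ⟨
    q′ ^ suc i * q ^ (suc m ∸ suc i) ∎

  count-eliminated : ∀ {n m} i N v (c : Vec (Fin q) n) (row : Vec (Fin q) m) → firstDiv i row ≡ true →
    ∑ (Mats n m) (λ O → 𝟙 (allᵥ (firstDiv i) O ∧ hasSolCount (eliminate v c row O) N)) ≡ Ei p i n m (suc s) N
  count-eliminated {n} {m} i N v c row row-firstDiv = begin
    ∑ (Mats n m) (λ O → 𝟙 (allᵥ (firstDiv i) O ∧ hasSolCount (eliminate v c row O) N))
      ≡⟨ ∑-cong (Mats n m) (λ O → cong (λ b → 𝟙 (b ∧ hasSolCount (eliminate v c row O) N))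
                                       (sym (allRows-eliminate (m∣m*n q′) i v c row O row-firstDiv))) ⟩
    ∑ (Mats n m) (f ∘ eliminate v c row)
      ≡⟨ ∑-eliminate n m v c row f ⟩
    ∑ (Mats n m) f
      ≡⟨ ∑-cong (Mats n m) (λ B → cong (λ b → 𝟙 (b ∧ hasSolCount B N)) (sym (firstColsDiv≡allRows p i B))) ⟩
    ∑ (Mats n m) (λ B → 𝟙 (firstColsDiv p i B ∧ hasSolCount B N))
      ≡⟨ count≡∑𝟙 _ (Mats n m) ⟨
    Ei p i n m (suc s) N ∎
    where
    f : Mat q n m → ℕ
    f B = 𝟙 (allᵥ (firstDiv i) B ∧ hasSolCount B N)

  count-completions-at-pivot : ∀ {n m} N (i : Fin (suc m)) (r : Fin (suc n)) (c : Vec (Fin q) n) (u : Fin q) →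
    ¬ p ∣ toℕ u →
    ∑ (Mats (suc n) m) (λ R → 𝟙 (allᵥ (firstDiv (toℕ i)) R ∧ hasSolCount (insertColumn i (insertAt c r u) R) N))
      ≡ (q′ ^ toℕ i * q ^ (m ∸ toℕ i)) * Ei p (toℕ i) n m (suc s) N
  count-completions-at-pivot {n} {m} N i r c u p∤u with negated-inverse p-prime s (toℕ u) p∤u
  ... | v , vu+1≋0 = begin
    ∑ (Mats (suc n) m) (λ R → 𝟙 (allᵥ (firstDiv k) R ∧ hasSolCount (insertColumn i (insertAt c r u) R) N))
      ≡⟨ ∑-vecsOf-insertAt (Vecs m) n r _ ⟩
    ∑ (Vecs m) (λ row → ∑ (Mats n m) (λ O →
      𝟙 (allᵥ (firstDiv k) (insertAt O r row) ∧ hasSolCount (insertColumn i (insertAt c r u) (insertAt O r row)) N)))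
      ≡⟨ ∑-cong (Vecs m) (λ row → ∑-cong (Mats n m) (λ O → cong 𝟙 (eliminate-pivot row O))) ⟩
    ∑ (Vecs m) (λ row → ∑ (Mats n m) (λ O → 𝟙 (firstDiv k row ∧ rest row O)))
      ≡⟨ ∑-cong (Vecs m) (λ row → ∑-𝟙-∧ (Mats n m) (firstDiv k row) (rest row)) ⟩
    ∑ (Vecs m) (λ row → 𝟙 (firstDiv k row) * ∑ (Mats n m) (𝟙 ∘ rest row))
      ≡⟨ ∑-cong (Vecs m) (λ row → 𝟙-*-cong (firstDiv k row) (count-eliminated k N v c row)) ⟩
    ∑ (Vecs m) (λ row → 𝟙 (firstDiv k row) * Ei p k n m (suc s) N)
      ≡⟨ ∑-*ʳ (Vecs m) _ _ ⟩
    ∑ (Vecs m) (𝟙 ∘ firstDiv k) * Ei p k n m (suc s) N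
      ≡⟨ cong (_* Ei p k n m (suc s) N) (count-firstDiv k m (Fin.toℕ≤pred[n] i)) ⟩
    (q′ ^ k * q ^ (m ∸ k)) * Ei p k n m (suc s) N ∎
    where
    k = toℕ i
    open Pivot v u vu+1≋0
    rest : Vec (Fin q) m → Mat q n m → Bool
    rest row O = allᵥ (firstDiv k) O ∧ hasSolCount (eliminate v c row O) N
    eliminate-pivot : ∀ row O →
      allᵥ (firstDiv k) (insertAt O r row) ∧ hasSolCount (insertColumn i (insertAt c r u) (insertAt O r row)) N
        ≡ firstDiv k row ∧ rest row O
    eliminate-pivot row O = begin
      allᵥ (firstDiv k) (insertAt O r row) ∧ hasSolCount (insertColumn i (insertAt c r u) (insertAt O r row)) N
        ≡⟨ cong₂ _∧_ (allᵥ-insertAt (firstDiv k) O r row)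
                     (cong (λ A → hasSolCount A N) (insertColumn-insertAt i r c u O row)) ⟩
      (firstDiv k row ∧ allᵥ (firstDiv k) O) ∧ hasSolCount (insertAt (insertColumn i c O) r (insertAt row i u)) N
        ≡⟨ ∧-assoc (firstDiv k row) _ _ ⟩
      firstDiv k row ∧ (allᵥ (firstDiv k) O ∧ hasSolCount (insertAt (insertColumn i c O) r (insertAt row i u)) N)
        ≡⟨ cong (λ z → firstDiv k row ∧ (allᵥ (firstDiv k) O ∧ ⌊ z ≟ N ⌋)) (numSolutions-pivot i r c O row) ⟩
      firstDiv k row ∧ rest row O ∎

  count-completions : ∀ {n m} N (i : Fin (suc m)) (c : Vec (Fin q) (suc n)) → not (allᵥ (divisibleBy p) c) ≡ true →
    ∑ (Mats (suc n) m) (λ R → 𝟙 (allᵥ (firstDiv (toℕ i)) R ∧ hasSolCount (insertColumn i c R) N))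
      ≡ (q′ ^ toℕ i * q ^ (m ∸ toℕ i)) * Ei p (toℕ i) n m (suc s) N
  count-completions N i c ¬all with not-allᵥ⁻ (divisibleBy p) c ¬all
  ... | r , ¬p∣cᵣ =
    subst (λ c → ∑ (Mats _ _) (λ R → 𝟙 (allᵥ (firstDiv (toℕ i)) R ∧ hasSolCount (insertColumn i c R) N)) ≡ _)
          (insertAt-removeAt c r)
          (count-completions-at-pivot N i r (removeAt c r) (lookup c r) p∤cᵣ)
    where
    p∤cᵣ : ¬ p ∣ toℕ (lookup c r)
    p∤cᵣ p∣cᵣ = contradiction (trans (sym (∣⇒divB p _ p∣cᵣ)) ¬p∣cᵣ) λ ()

  Etilde≡φ*Ei : ∀ n m N (i : Fin (suc m)) →
    Etilde p (toℕ i) (suc n) (suc m) (suc s) N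
      ≡ φ (suc n) q * (q′ ^ toℕ i * q ^ (m ∸ toℕ i)) * Ei p (toℕ i) n m (suc s) N
  Etilde≡φ*Ei n m N i = begin
    Etilde p k (suc n) (suc m) (suc s) N
      ≡⟨ count≡∑𝟙 _ (Mats (suc n) (suc m)) ⟩
    ∑ (Mats (suc n) (suc m)) (𝟙 ∘ test)
      ≡⟨ ∑-matrices-insertColumn (allFin q) (suc n) m i _ ⟩
    ∑ (Vecs (suc n)) (λ c → ∑ (Mats (suc n) m) (λ R → 𝟙 (test (insertColumn i c R))))
      ≡⟨ ∑-cong (Vecs (suc n)) (λ c → ∑-cong (Mats (suc n) m) (λ R →
           cong 𝟙 (Etilde-test-insertColumn p i c R (hasSolCount (insertColumn i c R) N)))) ⟩
    ∑ (Vecs (suc n)) (λ c → ∑ (Mats (suc n) m) (λ R → 𝟙 (newColumn c ∧ completes c R)))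
      ≡⟨ ∑-cong (Vecs (suc n)) (λ c → ∑-𝟙-∧ (Mats (suc n) m) (newColumn c) (completes c)) ⟩
    ∑ (Vecs (suc n)) (λ c → 𝟙 (newColumn c) * ∑ (Mats (suc n) m) (𝟙 ∘ completes c))
      ≡⟨ ∑-cong (Vecs (suc n)) (λ c → 𝟙-*-cong (newColumn c) (count-completions N i c)) ⟩
    ∑ (Vecs (suc n)) (λ c → 𝟙 (newColumn c) * K)
      ≡⟨ ∑-*ʳ (Vecs (suc n)) K (𝟙 ∘ newColumn) ⟩
    ∑ (Vecs (suc n)) (𝟙 ∘ newColumn) * K
      ≡⟨ cong (_* K) (count-nondivisible-columns p-prime s (suc n)) ⟩
    φ (suc n) q * K
      ≡⟨ *-assoc (φ (suc n) q) _ _ ⟨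
    φ (suc n) q * (q′ ^ k * q ^ (m ∸ k)) * Ei p k n m (suc s) N ∎
    where
    k = toℕ i
    test : Mat q (suc n) (suc m) → Bool
    test A = relPrime p A ∧ firstColsDiv p k A ∧ any (λ j → (toℕ j ≡ᵇ k) ∧ not (colDivBy p A j)) (allFin (suc m))
             ∧ hasSolCount A N
    newColumn : Vec (Fin q) (suc n) → Bool
    newColumn c = not (allᵥ (divisibleBy p) c)
    completes : Vec (Fin q) (suc n) → Mat q (suc n) m → Bool
    completes c R = allᵥ (firstDiv k) R ∧ hasSolCount (insertColumn i c R) N
    K = (q′ ^ k * q ^ (m ∸ k)) * Ei p k n m (suc s) N

  timesP : Fin q′ → Fin q
  timesP x = (p * toℕ x) mod q

  reduce : Fin q → Fin q′
  reduce y = toℕ y mod q′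

  toℕ-timesP : ∀ a → toℕ (timesP a) ≡ p * toℕ a
  toℕ-timesP a = toℕ-mod-< (*-monoʳ-< p (toℕ<n a))

  dot-timesP : {b : ℕ} (row : Vec (Fin q′) b) (y : Vec (Fin q) b) → dot (Vec.map timesP row) y ≡ p * dot row y
  dot-timesP []        []      = sym (*-zeroʳ p)
  dot-timesP (a ∷ row) (t ∷ y) =
    trans (cong₂ (λ z w → z * toℕ t + w) (toℕ-timesP a) (dot-timesP row y)) (factor p (toℕ a) (toℕ t) (dot row y))
    where
    factor : ∀ p a t d → p * a * t + p * d ≡ p * (a * t + d)
    factor = solve-∀

  dot-reduce : {b : ℕ} (row : Vec (Fin q′) b) (y : Vec (Fin q) b) → dot row y % q′ ≡ dot row (Vec.map reduce y) % q′
  dot-reduce []        []      = refl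
  dot-reduce (a ∷ row) (t ∷ y) =
    +-≋ (*-≋ (refl {x = toℕ a % q′}) (sym (trans (≡⇒≋ (toℕ-mod (toℕ t) q′)) (%-≋ (toℕ t))))) (dot-reduce row y)
    where open Congruence q′

  divB-*-cancelˡ : ∀ x → divB q (p * x) ≡ divB q′ x
  divB-*-cancelˡ x with q ∣? (p * x) | q′ ∣? x
  ... | yes _   | yes _    = refl
  ... | no  _   | no  _    = refl
  ... | yes q∣  | no  q′∤x = contradiction (*-cancelˡ-∣ p q∣) q′∤x
  ... | no  q∤  | yes q′∣x = contradiction (*-monoʳ-∣ p q′∣x) q∤

  isSolution-timesP : ∀ {a b} (B : Mat q′ a b) (y : Vec (Fin q) b) →
    isSolution (Vec.map (Vec.map timesP) B) y ≡ isSolution B (Vec.map reduce y)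
  isSolution-timesP []        y = refl
  isSolution-timesP (row ∷ B) y = cong₂ _∧_
    (trans (cong (divB q) (dot-timesP row y)) (trans (divB-*-cancelˡ (dot row y)) (divB-cong-% q′ (dot-reduce row y))))
    (isSolution-timesP B y)

  numSolutions-timesP : ∀ {a b} (B : Mat q′ a b) → numSolutions (Vec.map (Vec.map timesP) B) ≡ p ^ b * numSolutions B
  numSolutions-timesP {a} {b} B = begin
    numSolutions (Vec.map (Vec.map timesP) B)
      ≡⟨ count≡∑𝟙 _ (Vecs b) ⟩
    ∑ (Vecs b) (𝟙 ∘ isSolution (Vec.map (Vec.map timesP) B))
      ≡⟨ ∑-cong (Vecs b) (λ y → cong 𝟙 (isSolution-timesP B y)) ⟩
    ∑ (Vecs b) (λ y → 𝟙 (isSolution B (Vec.map reduce y)))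
      ≡⟨ ∑-vecsOf-reduce (allFin q) (allFin q′) reduce p (∑-allFin-reduce p q′) b (𝟙 ∘ isSolution B) ⟩
    p ^ b * ∑ (vecsOf (allFin q′) b) (𝟙 ∘ isSolution B)
      ≡⟨ cong (p ^ b *_) (count≡∑𝟙 _ (vecsOf (allFin q′) b)) ⟨
    p ^ b * numSolutions B ∎

  ⌊≟⌋-*-cancelˡ : ∀ k .{{_ : NonZero k}} x y → ⌊ k * x ≟ k * y ⌋ ≡ ⌊ x ≟ y ⌋
  ⌊≟⌋-*-cancelˡ k x y with k * x ≟ k * y | x ≟ y
  ... | yes _  | yes _  = refl
  ... | no  _  | no  _  = refl
  ... | yes kx≡ky | no x≢y = contradiction (*-cancelˡ-≡ x y k kx≡ky) x≢y
  ... | no kx≢ky  | yes x≡y = contradiction (cong (k *_) x≡y) kx≢ky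

  -- Matrices over ℤ_q with every entry divisible by p are exactly p times the matrices over ℤ_q′.
  Ei-all≡E : ∀ n m j → m ≤ j → Ei p m n m (suc s) (p ^ j) ≡ E p n m s (p ^ (j ∸ m))
  Ei-all≡E n m j m≤j = begin
    Ei p m n m (suc s) (p ^ j)
      ≡⟨ count≡∑𝟙 _ (Mats n m) ⟩
    ∑ (Mats n m) (λ B → 𝟙 (firstColsDiv p m B ∧ hasSolCount B (p ^ j)))
      ≡⟨ ∑-cong (Mats n m) (λ B → trans (cong (λ b → 𝟙 (b ∧ hasSolCount B (p ^ j))) (allDivisible B))
                                        (𝟙-∧ (allᵥ (allᵥ (divisibleBy p)) B) (hasSolCount B (p ^ j)))) ⟩
    ∑ (Mats n m) (λ B → 𝟙 (allᵥ (allᵥ (divisibleBy p)) B) * 𝟙 (hasSolCount B (p ^ j)))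
      ≡⟨ ∑-vecsOf-restrict (Vecs m) (vecsOf (allFin q′) m) (allᵥ (divisibleBy p)) (Vec.map timesP)
           (∑-vecsOf-restrict (allFin q) (allFin q′) (divisibleBy p) timesP (∑-allFin-multiples p q′) m)
           n (λ B → 𝟙 (hasSolCount B (p ^ j))) ⟩
    ∑ (vecsOf (vecsOf (allFin q′) m) n) (λ B → 𝟙 (hasSolCount (Vec.map (Vec.map timesP) B) (p ^ j)))
      ≡⟨ ∑-cong (vecsOf (vecsOf (allFin q′) m) n) (λ B → cong 𝟙 (scaled-count B)) ⟩
    ∑ (vecsOf (vecsOf (allFin q′) m) n) (λ B → 𝟙 (hasSolCount B (p ^ (j ∸ m))))
      ≡⟨ count≡∑𝟙 _ (vecsOf (vecsOf (allFin q′) m) n) ⟨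
    E p n m s (p ^ (j ∸ m)) ∎
    where
    instance
      pᵐ≢0 : NonZero (p ^ m)
      pᵐ≢0 = m^n≢0 p m
    allDivisible : ∀ B → firstColsDiv p m B ≡ allᵥ (allᵥ (divisibleBy p)) B
    allDivisible B = trans (firstColsDiv≡allRows p m B) (allᵥ-cong (prefixAll-full (divisibleBy p)) B)
    pʲ≡pᵐ*pʲ⁻ᵐ : p ^ j ≡ p ^ m * p ^ (j ∸ m)
    pʲ≡pᵐ*pʲ⁻ᵐ = trans (cong (p ^_) (sym (m+[n∸m]≡n m≤j))) (^-distribˡ-+-* p m (j ∸ m))
    scaled-count : ∀ B → hasSolCount (Vec.map (Vec.map timesP) B) (p ^ j) ≡ hasSolCount B (p ^ (j ∸ m))
    scaled-count B = begin
      ⌊ numSolutions (Vec.map (Vec.map timesP) B) ≟ p ^ j ⌋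
        ≡⟨ cong₂ (λ x y → ⌊ x ≟ y ⌋) (numSolutions-timesP B) pʲ≡pᵐ*pʲ⁻ᵐ ⟩
      ⌊ p ^ m * numSolutions B ≟ p ^ m * p ^ (j ∸ m) ⌋               ≡⟨ ⌊≟⌋-*-cancelˡ (p ^ m) _ _ ⟩
      ⌊ numSolutions B ≟ p ^ (j ∸ m) ⌋                               ∎

  Etilde-formula : ∀ n m i N → i ≤ m →
    Etilde p i (suc n) (suc m) (suc s) N ≡ φ (suc n) q * q′ ^ i * q ^ (m ∸ i) * Ei p i n m (suc s) N
  Etilde-formula n m i N i≤m = begin
    Etilde p i (suc n) (suc m) (suc s) N
      ≡⟨ cong (λ k → Etilde p k (suc n) (suc m) (suc s) N) toℕ-i ⟨
    Etilde p (toℕ iᶠ) (suc n) (suc m) (suc s) N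
      ≡⟨ Etilde≡φ*Ei n m N iᶠ ⟩
    φ (suc n) q * (q′ ^ toℕ iᶠ * q ^ (m ∸ toℕ iᶠ)) * Ei p (toℕ iᶠ) n m (suc s) N
      ≡⟨ cong (λ k → φ (suc n) q * (q′ ^ k * q ^ (m ∸ k)) * Ei p k n m (suc s) N) toℕ-i ⟩
    φ (suc n) q * (q′ ^ i * q ^ (m ∸ i)) * Ei p i n m (suc s) N
      ≡⟨ cong (_* Ei p i n m (suc s) N) (*-assoc (φ (suc n) q) _ _) ⟨
    φ (suc n) q * q′ ^ i * q ^ (m ∸ i) * Ei p i n m (suc s) N ∎
    where
    iᶠ : Fin (suc m)
    iᶠ = fromℕ< (s≤s i≤m)
    toℕ-i : toℕ iᶠ ≡ i
    toℕ-i = toℕ-fromℕ< (s≤s i≤m)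

lemma3p8 : (p s n m i j : ℕ) → Prime p → 1 ≤ s → 2 ≤ n → 2 ≤ m →
    i ≤ j → i ≤ m ∸ 1 →
    (i < m ∸ 1 →
      Etilde p i n m s (p ^ j)
        ≡ φ n (p ^ s) * (p ^ (s ∸ 1)) ^ i * (p ^ s) ^ (m ∸ (i + 1))
          * Ei p i (n ∸ 1) (m ∸ 1) s (p ^ j))
    × (i ≡ m ∸ 1 →
      Etilde p (m ∸ 1) n m s (p ^ j)
        ≡ φ n (p ^ s) * (p ^ (s ∸ 1)) ^ (m ∸ 1)
          * E p (n ∸ 1) (m ∸ 1) (s ∸ 1) (p ^ (j ∸ (m ∸ 1))))
lemma3p8 p (suc s) (suc n) (suc m) i j p-prime _ _ _ i≤j i≤m = below-last , last
  where
  open Counting p-prime s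
  below-last : i < m → _
  below-last _ = begin
    Etilde p i (suc n) (suc m) (suc s) (p ^ j)
      ≡⟨ Etilde-formula n m i (p ^ j) i≤m ⟩
    φ (suc n) q * q′ ^ i * q ^ (m ∸ i) * Ei p i n m (suc s) (p ^ j)
      ≡⟨ cong (λ k → φ (suc n) q * q′ ^ i * q ^ (suc m ∸ k) * Ei p i n m (suc s) (p ^ j)) (+-comm 1 i) ⟩
    φ (suc n) q * q′ ^ i * q ^ (suc m ∸ (i + 1)) * Ei p i n m (suc s) (p ^ j) ∎
  last : i ≡ m → _
  last refl = begin
    Etilde p i (suc n) (suc i) (suc s) (p ^ j)
      ≡⟨ Etilde-formula n i i (p ^ j) ≤-refl ⟩
    φ (suc n) q * q′ ^ i * q ^ (i ∸ i) * Ei p i n i (suc s) (p ^ j)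
      ≡⟨ cong₂ (λ k e → φ (suc n) q * q′ ^ i * q ^ k * e) (n∸n≡0 i) (Ei-all≡E n i j i≤j) ⟩
    φ (suc n) q * q′ ^ i * 1 * E p n i s (p ^ (j ∸ i))
      ≡⟨ cong (_* E p n i s (p ^ (j ∸ i))) (*-identityʳ (φ (suc n) q * q′ ^ i)) ⟩
    φ (suc n) q * q′ ^ i * E p n i s (p ^ (j ∸ i)) ∎
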